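{- Let $G$ be a connected triangle-free graph of order $n$, size $m$ (number of edges), minimum degree $\delta$ and vertex-connectivity $\kappa$, and let $k$ be an integer with $\delta\geq k\geq 2$. If $$m \geq \delta^2+\left\lfloor\tfrac14 (n-2\delta+k-1)^2\right\rfloor,$$ then $\kappa\geq k$, unless $V(G)=X\cup S\cup Y$ (disjoint union) where $S$ is a minimum vertex-cut of $G$ with $G[S]=\overline{K_{k-1}}$ (i.e. $S$ is an independent set of $k-1$ vertices), $G[X\cup S]\cong K_{\delta, \delta}$ and $G[Y\cup S] \cong K_{\lceil(n-2\delta+k-1)/2\rceil,\lfloor(n-2\delta+k-1)/2\rfloor}$.
   Context: All graphs are finite, simple and undirected. A vertex-cut of a connected graph is a set of vertices whose removal disconnects it; the vertex-connectivity $\kappa(G)$ of a connected non-complete graph is the minimum size of a vertex-cut, and $\kappa(K_n)=n-1$; a minimum vertex-cut is one of size $\kappa(G)$. $G[Z]$ is the subgraph induced by $Z$, $\overline{K_r}$ is the edgeless graph on $r$ vertices, and $K_{a,b}$ is the complete bipartite graph. -}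

module Defs where

open import Data.Nat using (ℕ; zero; suc; _+_; _*_; _∸_; _≤_; _<ᵇ_)
open import Data.Fin using (Fin; toℕ)
open import Data.Fin.Subset using (Subset; _∈_; _∉_; ∁; ⊤; ∣_∣)
open import Data.Bool using (Bool; true; false; _∧_; _xor_; if_then_else_)
open import Data.List using (List; map; allFin)
open import Data.Nat.ListAction using (sum)
open import Data.Product using (Σ; ∃; ∃₂; _×_)
open import Data.Sum using (_⊎_)
open import Data.Empty using (⊥)
open import Relation.Nullary using (¬_)
open import Relation.Binary.PropositionalEquality using (_≡_; _≢_; refl)
open import Function.Definitions using (Injective)
open import Function.Bundles using (_⇔_)

record Graph (n : ℕ) : Set where
  field
    adj    : Fin n → Fin n → Bool
    sym    : ∀ u v → adj u v ≡ adj v u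
    irrefl : ∀ v → adj v v ≡ false
open Graph public

module _ {n : ℕ} (G : Graph n) where

  Adj : Fin n → Fin n → Set
  Adj u v = adj G u v ≡ true

  degree : Fin n → ℕ
  degree v = sum (map (λ u → if adj G v u then 1 else 0) (allFin n))

  size : ℕ
  size = sum (map (λ u → sum (map (λ v → if adj G u v ∧ (toℕ u <ᵇ toℕ v) then 1 else 0)
                                  (allFin n)))
                  (allFin n))

  TriangleFree : Set
  TriangleFree = ∀ u v w → Adj u v → Adj v w → Adj u w → ⊥

  IsMinDegree : ℕ → Set
  IsMinDegree δ = (∀ v → δ ≤ degree v) × (∃ λ v → degree v ≡ δ)

  data Reach (R : Subset n) : Fin n → Fin n → Set where
    here : ∀ {v} → v ∈ R → Reach R v v
    step : ∀ {u v w} → u ∈ R → Adj u v → Reach R v w → Reach R u w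

  Connected : Set
  Connected = ∀ u v → Reach ⊤ u v

  IsVertexCut : Subset n → Set
  IsVertexCut S = ∃₂ λ u v → u ∉ S × v ∉ S × ¬ Reach (∁ S) u v

  IsComplete : Set
  IsComplete = ∀ u v → u ≢ v → Adj u v

  IsConnectivity : ℕ → Set
  IsConnectivity κ =
      (IsComplete × κ ≡ n ∸ 1)
    ⊎ (¬ IsComplete × (∃ λ S → IsVertexCut S × ∣ S ∣ ≡ κ)
                    × (∀ S → IsVertexCut S → κ ≤ ∣ S ∣))

  IsMinVertexCut : Subset n → Set
  IsMinVertexCut S = IsVertexCut S × (∀ T → IsVertexCut T → ∣ S ∣ ≤ ∣ T ∣)

  InducedIso : Subset n → {r : ℕ} → Graph r → Set
  InducedIso Z {r} H =
    Σ (Fin r → Fin n) λ f →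
      Injective _≡_ _≡_ f
      × (∀ v → v ∈ Z ⇔ (∃ λ i → f i ≡ v))
      × (∀ i j → adj G (f i) (f j) ≡ adj H i j)

  Partition3 : Subset n → Subset n → Subset n → Set
  Partition3 X S Y =
      (∀ v → v ∈ X ⊎ v ∈ S ⊎ v ∈ Y)
    × (∀ v → v ∈ X → v ∈ S → ⊥)
    × (∀ v → v ∈ X → v ∈ Y → ⊥)
    × (∀ v → v ∈ S → v ∈ Y → ⊥)

emptyGraph : (r : ℕ) → Graph r
emptyGraph r = record { adj = λ _ _ → false ; sym = λ _ _ → refl ; irrefl = λ _ → refl }

private
  xor-comm : ∀ x y → x xor y ≡ y xor x
  xor-comm false false = refl
  xor-comm false true  = refl
  xor-comm true  false = refl
  xor-comm true  true  = refl

  xor-self : ∀ x → x xor x ≡ false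
  xor-self false = refl
  xor-self true  = refl

-- complete bipartite graph K_{a,b} on Fin (a + b): parts {i < a} and {i ≥ a}
completeBipartite : (a b : ℕ) → Graph (a + b)
completeBipartite a b = record
  { adj    = λ i j → (toℕ i <ᵇ a) xor (toℕ j <ᵇ a)
  ; sym    = λ i j → xor-comm (toℕ i <ᵇ a) (toℕ j <ᵇ a)
  ; irrefl = λ i → xor-self (toℕ i <ᵇ a)
  }

-- Suppose κ < k and let S be a minimum vertex-cut, so |S| = κ ≤ k − 1 < δ. Let A be a component
-- of G − S, B the rest of G − S, T = A ∪ S and U = B ∪ S; then |T| + |U| = n + κ and every edge
-- lies in G[T] or G[U], those inside S in both. A vertex of A has a neighbour in A, because S is
-- too small to contain its δ neighbours, and adjacent vertices have disjoint neighbourhoods, so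
-- |T| ≥ 2δ, and likewise |U| ≥ 2δ. Mantel's theorem bounds e(G[T]) + e(G[U]) by
-- ⌊|T|²/4⌋ + ⌊|U|²/4⌋, and comparing with m ≥ δ² + ⌊(n − 2δ + k − 1)²/4⌋ forces, by convexity,
-- κ = k − 1 and {|T|, |U|} = {2δ, n − 2δ + k − 1}. Then every inequality used is tight: S is
-- independent and G[T], G[U] attain Mantel's bound, so both are balanced complete bipartite.

module Submission where

open import Data.Bool using (Bool; true; false; _∧_; _∨_; not; if_then_else_)
open import Data.Bool.Properties using (∧-identityʳ; ∧-zeroʳ; ∨-zeroʳ; ¬-not; T-≡) renaming (_≟_ to _≟ᵇ_)
open import Data.Empty using (⊥; ⊥-elim)
open import Data.Fin using (Fin; zero; suc; toℕ; splitAt; _↑ˡ_; _↑ʳ_)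
open import Data.Fin.Properties using (any?) renaming (_≟_ to _≟ᶠ_)
import Data.Fin.Properties as Finₚ
open import Data.Fin.Subset using (Subset; _∈_; _∉_; ∁; _∪_; ∣_∣)
open import Data.Fin.Subset.Properties using (x∉p⇒x∈∁p; x∈∁p⇒x∉p)
import Data.List as List
open import Data.List.Extrema.Nat using (argmax; v≤f[argmax]⁺)
open import Data.List.Membership.Propositional.Properties using (∈-allFin)
open import Data.List.Properties using (map-tabulate)
import Data.List.Relation.Unary.Any as Any
open import Data.Nat
  using (ℕ; zero; suc; _+_; _*_; _∸_; _≤_; _<_; z≤n; s≤s; s≤s⁻¹; _<ᵇ_; _/_; ⌊_/2⌋; ⌈_/2⌉; >-nonZero)
open import Data.Nat.Divisibility using (divides)
open import Data.Nat.DivMod using (m*n/n≡m; +-distrib-/-∣ʳ; m/n≡1+[m∸n]/n)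
open import Data.Nat.ListAction using () renaming (sum to sumˡ)
open import Data.Nat.Properties
open import Data.Nat.Tactic.RingSolver using (solve-∀)
open import Algebra.Properties.Semiring.Sum +-*-semiring
  using (sum; sum-syntax; ∑-distrib-+; ∑-comm; sum-cong-≗; *-distribˡ-sum; *-distribʳ-sum; sum-replicate-zero)
open import Data.Product using (Σ; ∃; ∃₂; _×_; _,_; proj₁; proj₂; uncurry)
open import Data.Sum using (_⊎_; inj₁; inj₂; [_,_]′)
open import Data.Vec using ([]; _∷_; lookup; tabulate)
open import Data.Vec.Properties using ([]=⇒lookup; lookup⇒[]=; lookup∘tabulate; lookup-zipWith)
open import Defs hiding (sym)
open import Function using (_∘_)
open import Function.Bundles using (Equivalence; _⇔_; mk⇔)
open import Relation.Binary.Definitions using (tri<; tri≈; tri>)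
open import Relation.Binary.PropositionalEquality
open import Relation.Nullary using (¬_; Dec; yes; no; does; contradiction)

sum-tabulate : ∀ {n} (f : Fin n → ℕ) → sumˡ (List.tabulate f) ≡ sum f
sum-tabulate {zero}  f = refl
sum-tabulate {suc n} f = cong (f zero +_) (sum-tabulate (f ∘ suc))

sum-map-allFin : ∀ {n} (f : Fin n → ℕ) → sumˡ (List.map f (List.allFin n)) ≡ sum f
sum-map-allFin {n} f = trans (cong sumˡ (map-tabulate (λ i → i) f)) (sum-tabulate f)

∑-mono-≤ : ∀ {n} {f g : Fin n → ℕ} → (∀ i → f i ≤ g i) → sum f ≤ sum g
∑-mono-≤ {zero}  f≤g = z≤n
∑-mono-≤ {suc n} f≤g = +-mono-≤ (f≤g zero) (∑-mono-≤ (f≤g ∘ suc))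

f≤∑f : ∀ {n} (f : Fin n → ℕ) i → f i ≤ sum f
f≤∑f f zero    = m≤m+n (f zero) _
f≤∑f f (suc i) = ≤-trans (f≤∑f (f ∘ suc) i) (m≤n+m _ (f zero))

∑≡0⇒≡0 : ∀ {n} (f : Fin n → ℕ) → sum f ≡ 0 → ∀ i → f i ≡ 0
∑≡0⇒≡0 f ∑f≡0 i = n≤0⇒n≡0 (subst (f i ≤_) ∑f≡0 (f≤∑f f i))

∑1≡n : ∀ n → ∑[ i < n ] 1 ≡ n
∑1≡n zero    = refl
∑1≡n (suc n) = cong suc (∑1≡n n)

≤-pointwise∧∑≥⇒≡ : ∀ {n} (f g : Fin n → ℕ) → (∀ i → f i ≤ g i) → sum g ≤ sum f →
                   ∀ i → f i ≡ g i
≤-pointwise∧∑≥⇒≡ f g f≤g ∑g≤∑f zero = ≤-antisym (f≤g zero)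
  (+-cancelʳ-≤ _ _ _ (≤-trans (+-monoʳ-≤ (g zero) (∑-mono-≤ (f≤g ∘ suc))) ∑g≤∑f))
≤-pointwise∧∑≥⇒≡ f g f≤g ∑g≤∑f (suc i) =
  ≤-pointwise∧∑≥⇒≡ (f ∘ suc) (g ∘ suc) (f≤g ∘ suc)
    (+-cancelˡ-≤ (f zero) _ _ (≤-trans (+-monoˡ-≤ _ (f≤g zero)) ∑g≤∑f)) i

-- The function ⌊n²/4⌋

⌊n/2⌋≡n/2 : ∀ n → ⌊ n /2⌋ ≡ n / 2
⌊n/2⌋≡n/2 0             = refl
⌊n/2⌋≡n/2 1             = refl
⌊n/2⌋≡n/2 (suc (suc n)) =
  trans (cong suc (⌊n/2⌋≡n/2 n)) (sym (m/n≡1+[m∸n]/n {suc (suc n)} {2} (s≤s (s≤s z≤n))))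

⌊_²/4⌋ : ℕ → ℕ
⌊ 0 ²/4⌋           = 0
⌊ 1 ²/4⌋           = 0
⌊ suc (suc n) ²/4⌋ = ⌊ n ²/4⌋ + suc n

⌊n²/4⌋≡n*n/4 : ∀ n → ⌊ n ²/4⌋ ≡ n * n / 4
⌊n²/4⌋≡n*n/4 0             = refl
⌊n²/4⌋≡n*n/4 1             = refl
⌊n²/4⌋≡n*n/4 (suc (suc n)) = begin
  ⌊ n ²/4⌋ + suc n              ≡⟨ cong₂ _+_ (⌊n²/4⌋≡n*n/4 n) (sym (m*n/n≡m (suc n) 4)) ⟩
  n * n / 4 + suc n * 4 / 4     ≡⟨ sym (+-distrib-/-∣ʳ (n * n) (divides (suc n) refl)) ⟩
  (n * n + suc n * 4) / 4       ≡⟨ cong (_/ 4) (square n) ⟩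
  suc (suc n) * suc (suc n) / 4 ∎
  where
  open ≡-Reasoning
  square : ∀ n → n * n + suc n * 4 ≡ suc (suc n) * suc (suc n)
  square = solve-∀

⌊[1+n]²/4⌋≡⌊n²/4⌋+⌈n/2⌉ : ∀ n → ⌊ suc n ²/4⌋ ≡ ⌊ n ²/4⌋ + ⌈ n /2⌉
⌊[1+n]²/4⌋≡⌊n²/4⌋+⌈n/2⌉ 0             = refl
⌊[1+n]²/4⌋≡⌊n²/4⌋+⌈n/2⌉ 1             = refl
⌊[1+n]²/4⌋≡⌊n²/4⌋+⌈n/2⌉ (suc (suc n)) =
  trans (cong (_+ suc (suc n)) (⌊[1+n]²/4⌋≡⌊n²/4⌋+⌈n/2⌉ n)) (reorder ⌊ n ²/4⌋ ⌈ n /2⌉ n)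
  where
  reorder : ∀ f h n → f + h + suc (suc n) ≡ f + suc n + suc h
  reorder = solve-∀

⌊n²/4⌋≤⌊[1+n]²/4⌋ : ∀ n → ⌊ n ²/4⌋ ≤ ⌊ suc n ²/4⌋
⌊n²/4⌋≤⌊[1+n]²/4⌋ n = ≤-trans (m≤m+n _ _) (≤-reflexive (sym (⌊[1+n]²/4⌋≡⌊n²/4⌋+⌈n/2⌉ n)))

⌊n²/4⌋<⌊[1+n]²/4⌋ : ∀ n → 1 ≤ n → ⌊ n ²/4⌋ < ⌊ suc n ²/4⌋
⌊n²/4⌋<⌊[1+n]²/4⌋ (suc n) _ =
  ≤-trans (≤-reflexive (+-comm 1 _))
    (≤-trans (+-monoʳ-≤ _ (s≤s z≤n)) (≤-reflexive (sym (⌊[1+n]²/4⌋≡⌊n²/4⌋+⌈n/2⌉ (suc n)))))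

⌊²/4⌋-mono-≤ : ∀ {m n} → m ≤ n → ⌊ m ²/4⌋ ≤ ⌊ n ²/4⌋
⌊²/4⌋-mono-≤ {m} m≤n with m≤n⇒∃[o]m+o≡n m≤n
... | o , refl = go o
  where
  go : ∀ o → ⌊ m ²/4⌋ ≤ ⌊ m + o ²/4⌋
  go zero    = ≤-reflexive (cong ⌊_²/4⌋ (sym (+-identityʳ m)))
  go (suc o) = ≤-trans (go o)
    (≤-trans (⌊n²/4⌋≤⌊[1+n]²/4⌋ (m + o)) (≤-reflexive (cong ⌊_²/4⌋ (sym (+-suc m o)))))

⌊[d+d+a]²/4⌋≡d*d+d*a+⌊a²/4⌋ : ∀ d a → ⌊ d + d + a ²/4⌋ ≡ d * d + d * a + ⌊ a ²/4⌋
⌊[d+d+a]²/4⌋≡d*d+d*a+⌊a²/4⌋ zero    a = refl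
⌊[d+d+a]²/4⌋≡d*d+d*a+⌊a²/4⌋ (suc d) a rewrite +-suc d d =
  trans (cong (_+ suc (d + d + a)) (⌊[d+d+a]²/4⌋≡d*d+d*a+⌊a²/4⌋ d a)) (expand d a ⌊ a ²/4⌋)
  where
  expand : ∀ d a f → d * d + d * a + f + suc (d + d + a) ≡ suc d * suc d + suc d * a + f
  expand = solve-∀

⌊[d+d]²/4⌋≡d*d : ∀ d → ⌊ d + d ²/4⌋ ≡ d * d
⌊[d+d]²/4⌋≡d*d d = begin
  ⌊ d + d ²/4⌋                     ≡⟨ cong ⌊_²/4⌋ (sym (+-identityʳ (d + d))) ⟩
  ⌊ d + d + 0 ²/4⌋                 ≡⟨ ⌊[d+d+a]²/4⌋≡d*d+d*a+⌊a²/4⌋ d 0 ⟩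
  d * d + d * 0 + 0                ≡⟨ cong (λ z → d * d + z + 0) (*-zeroʳ d) ⟩
  d * d + 0 + 0                    ≡⟨ trans (+-identityʳ _) (+-identityʳ _) ⟩
  d * d                            ∎
  where open ≡-Reasoning

⌊²/4⌋-superadditive : ∀ a b → ⌊ a ²/4⌋ + ⌊ b ²/4⌋ ≤ ⌊ a + b ²/4⌋
⌊²/4⌋-superadditive a 0 =
  ≤-reflexive (trans (+-identityʳ _) (cong ⌊_²/4⌋ (sym (+-identityʳ a))))
⌊²/4⌋-superadditive a 1 =
  ≤-trans (≤-reflexive (+-identityʳ _))
    (≤-trans (⌊n²/4⌋≤⌊[1+n]²/4⌋ a) (≤-reflexive (cong ⌊_²/4⌋ (+-comm 1 a))))
⌊²/4⌋-superadditive a (suc (suc b)) = begin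
  ⌊ a ²/4⌋ + (⌊ b ²/4⌋ + suc b)   ≡⟨ sym (+-assoc ⌊ a ²/4⌋ ⌊ b ²/4⌋ (suc b)) ⟩
  ⌊ a ²/4⌋ + ⌊ b ²/4⌋ + suc b     ≤⟨ +-mono-≤ (⌊²/4⌋-superadditive a b) (s≤s (m≤n+m b a)) ⟩
  ⌊ a + b ²/4⌋ + suc (a + b)      ≡⟨ cong ⌊_²/4⌋ (sym (+-suc² a b)) ⟩
  ⌊ a + suc (suc b) ²/4⌋          ∎
  where
  open ≤-Reasoning
  +-suc² : ∀ a b → a + suc (suc b) ≡ suc (suc (a + b))
  +-suc² a b = trans (+-suc a (suc b)) (cong suc (+-suc a b))

⌊²/4⌋-superadditive-< : ∀ a b → 1 ≤ a → 1 ≤ b → ⌊ a ²/4⌋ + ⌊ b ²/4⌋ < ⌊ a + b ²/4⌋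
⌊²/4⌋-superadditive-< a 1 1≤a _ = begin-strict
  ⌊ a ²/4⌋ + 0   ≡⟨ +-identityʳ _ ⟩
  ⌊ a ²/4⌋       <⟨ ⌊n²/4⌋<⌊[1+n]²/4⌋ a 1≤a ⟩
  ⌊ suc a ²/4⌋   ≡⟨ cong ⌊_²/4⌋ (+-comm 1 a) ⟩
  ⌊ a + 1 ²/4⌋   ∎
  where open ≤-Reasoning
⌊²/4⌋-superadditive-< a (suc (suc b)) 1≤a _ = begin-strict
  ⌊ a ²/4⌋ + (⌊ b ²/4⌋ + suc b)   ≡⟨ sym (+-assoc ⌊ a ²/4⌋ ⌊ b ²/4⌋ (suc b)) ⟩
  ⌊ a ²/4⌋ + ⌊ b ²/4⌋ + suc b     <⟨ +-mono-≤-< (⌊²/4⌋-superadditive a b) (s≤s (m<n+m b 1≤a)) ⟩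
  ⌊ a + b ²/4⌋ + suc (a + b)      ≡⟨ cong ⌊_²/4⌋ (sym (trans (+-suc a (suc b)) (cong suc (+-suc a b)))) ⟩
  ⌊ a + suc (suc b) ²/4⌋          ∎
  where open ≤-Reasoning

m≤n⇒m*n≤⌊[m+n]²/4⌋ : ∀ {m n} → m ≤ n → m * n ≤ ⌊ m + n ²/4⌋
m≤n⇒m*n≤⌊[m+n]²/4⌋ {m} m≤n with m≤n⇒∃[o]m+o≡n m≤n
... | e , refl = begin
  m * (m + e)               ≡⟨ *-distribˡ-+ m m e ⟩
  m * m + m * e             ≤⟨ m≤m+n _ _ ⟩
  m * m + m * e + ⌊ e ²/4⌋  ≡⟨ sym (⌊[d+d+a]²/4⌋≡d*d+d*a+⌊a²/4⌋ m e) ⟩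
  ⌊ m + m + e ²/4⌋          ≡⟨ cong ⌊_²/4⌋ (+-assoc m m e) ⟩
  ⌊ m + (m + e) ²/4⌋        ∎
  where open ≤-Reasoning

m*n≤⌊[m+n]²/4⌋ : ∀ m n → m * n ≤ ⌊ m + n ²/4⌋
m*n≤⌊[m+n]²/4⌋ m n with ≤-total m n
... | inj₁ m≤n = m≤n⇒m*n≤⌊[m+n]²/4⌋ m≤n
... | inj₂ n≤m = subst₂ _≤_ (*-comm n m) (cong ⌊_²/4⌋ (+-comm n m)) (m≤n⇒m*n≤⌊[m+n]²/4⌋ n≤m)

Balanced : ℕ → ℕ → Set
Balanced m n = (m ≡ ⌈ m + n /2⌉ × n ≡ ⌊ m + n /2⌋) ⊎ (m ≡ ⌊ m + n /2⌋ × n ≡ ⌈ m + n /2⌉)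

Balanced-sym : ∀ {m n} → Balanced m n → Balanced n m
Balanced-sym {m} {n} (inj₁ (m≡⌈⌉ , n≡⌊⌋)) rewrite +-comm m n = inj₂ (n≡⌊⌋ , m≡⌈⌉)
Balanced-sym {m} {n} (inj₂ (m≡⌊⌋ , n≡⌈⌉)) rewrite +-comm m n = inj₁ (n≡⌈⌉ , m≡⌊⌋)

m≤n∧⌊[m+n]²/4⌋≤m*n⇒Balanced : ∀ {m n} → m ≤ n → ⌊ m + n ²/4⌋ ≤ m * n → Balanced m n
m≤n∧⌊[m+n]²/4⌋≤m*n⇒Balanced {m} m≤n tight with m≤n⇒∃[o]m+o≡n m≤n
... | e , refl = balanced e ⌊e²/4⌋≡0
  where
  ⌊e²/4⌋≡0 : ⌊ e ²/4⌋ ≡ 0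
  ⌊e²/4⌋≡0 = n≤0⇒n≡0 (+-cancelˡ-≤ (m * m + m * e) _ _ (begin
    m * m + m * e + ⌊ e ²/4⌋  ≡⟨ sym (⌊[d+d+a]²/4⌋≡d*d+d*a+⌊a²/4⌋ m e) ⟩
    ⌊ m + m + e ²/4⌋          ≡⟨ cong ⌊_²/4⌋ (+-assoc m m e) ⟩
    ⌊ m + (m + e) ²/4⌋        ≤⟨ tight ⟩
    m * (m + e)               ≡⟨ *-distribˡ-+ m m e ⟩
    m * m + m * e             ≡⟨ sym (+-identityʳ _) ⟩
    m * m + m * e + 0         ∎))
    where open ≤-Reasoning
  balanced : ∀ e → ⌊ e ²/4⌋ ≡ 0 → Balanced m (m + e)
  balanced 0 _ rewrite +-identityʳ m = inj₁ (n≡⌈n+n/2⌉ m , n≡⌊n+n/2⌋ m)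
  balanced 1 _ rewrite +-suc m 0 | +-identityʳ m | +-suc m m =
    inj₂ (n≡⌈n+n/2⌉ m , cong suc (n≡⌊n+n/2⌋ m))
  balanced (suc (suc e)) ⌊[2+e]²/4⌋≡0 = ⊥-elim (m+1+n≢0 ⌊ e ²/4⌋ ⌊[2+e]²/4⌋≡0)

⌊[m+n]²/4⌋≤m*n⇒Balanced : ∀ m n → ⌊ m + n ²/4⌋ ≤ m * n → Balanced m n
⌊[m+n]²/4⌋≤m*n⇒Balanced m n tight with ≤-total m n
... | inj₁ m≤n = m≤n∧⌊[m+n]²/4⌋≤m*n⇒Balanced m≤n tight
... | inj₂ n≤m = Balanced-sym (m≤n∧⌊[m+n]²/4⌋≤m*n⇒Balanced n≤m
                   (subst₂ _≤_ (cong ⌊_²/4⌋ (+-comm m n)) (*-comm m n) tight))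

extremal-split : ∀ d a b c → 1 ≤ d → a + b ≤ c →
  d * d + ⌊ d + d + c ²/4⌋ ≤ ⌊ d + d + a ²/4⌋ + ⌊ d + d + b ²/4⌋ →
  (a ≡ 0 × b ≡ c) ⊎ (b ≡ 0 × a ≡ c)
extremal-split d a b c 1≤d a+b≤c hyp = split a b a+b≡c reduced
  where
  open ≤-Reasoning
  reduced : d * c + ⌊ c ²/4⌋ ≤ d * (a + b) + (⌊ a ²/4⌋ + ⌊ b ²/4⌋)
  reduced = +-cancelˡ-≤ (d * d + d * d) _ _ (begin
    d * d + d * d + (d * c + ⌊ c ²/4⌋)
      ≡⟨ regroup₁ (d * d) (d * c) ⌊ c ²/4⌋ ⟩
    d * d + (d * d + d * c + ⌊ c ²/4⌋)
      ≡⟨ cong (d * d +_) (sym (⌊[d+d+a]²/4⌋≡d*d+d*a+⌊a²/4⌋ d c)) ⟩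
    d * d + ⌊ d + d + c ²/4⌋
      ≤⟨ hyp ⟩
    ⌊ d + d + a ²/4⌋ + ⌊ d + d + b ²/4⌋
      ≡⟨ cong₂ _+_ (⌊[d+d+a]²/4⌋≡d*d+d*a+⌊a²/4⌋ d a) (⌊[d+d+a]²/4⌋≡d*d+d*a+⌊a²/4⌋ d b) ⟩
    d * d + d * a + ⌊ a ²/4⌋ + (d * d + d * b + ⌊ b ²/4⌋)
      ≡⟨ regroup₂ d a b ⌊ a ²/4⌋ ⌊ b ²/4⌋ ⟩
    d * d + d * d + (d * (a + b) + (⌊ a ²/4⌋ + ⌊ b ²/4⌋)) ∎)
    where
    regroup₁ : ∀ x y z → x + x + (y + z) ≡ x + (x + y + z)
    regroup₁ = solve-∀
    regroup₂ : ∀ d a b fa fb → d * d + d * a + fa + (d * d + d * b + fb)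
                             ≡ d * d + d * d + (d * (a + b) + (fa + fb))
    regroup₂ = solve-∀
  a+b≡c : a + b ≡ c
  a+b≡c with m≤n⇒m<n∨m≡n a+b≤c
  ... | inj₂ a+b≡c = a+b≡c
  ... | inj₁ a+b<c = ⊥-elim (<⇒≱ (begin-strict
    d * (a + b) + (⌊ a ²/4⌋ + ⌊ b ²/4⌋) ≤⟨ +-monoʳ-≤ (d * (a + b)) (⌊²/4⌋-superadditive a b) ⟩
    d * (a + b) + ⌊ a + b ²/4⌋         <⟨ +-mono-<-≤ (*-monoʳ-< d {{>-nonZero 1≤d}} a+b<c)
                                                        (⌊²/4⌋-mono-≤ (<⇒≤ a+b<c)) ⟩
    d * c + ⌊ c ²/4⌋                   ∎) reduced)
  split : ∀ a b → a + b ≡ c → d * c + ⌊ c ²/4⌋ ≤ d * (a + b) + (⌊ a ²/4⌋ + ⌊ b ²/4⌋) →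
          (a ≡ 0 × b ≡ c) ⊎ (b ≡ 0 × a ≡ c)
  split zero    b       b≡c _ = inj₁ (refl , b≡c)
  split (suc a) zero    a+0≡c _ = inj₂ (refl , trans (sym (+-identityʳ (suc a))) a+0≡c)
  split (suc a) (suc b) refl le = ⊥-elim (<⇒≱ (+-monoʳ-< (d * (suc a + suc b))
    (⌊²/4⌋-superadditive-< (suc a) (suc b) (s≤s z≤n) (s≤s z≤n))) le)

surplus : ∀ n κ j δ a b → δ + δ + a + (δ + δ + b) ≡ n + κ →
          n + (suc κ + j) ∸ (2 * δ + 1) ≡ δ + δ + (a + b + j)
surplus n κ j δ a b t+u≡n+κ = begin
  n + (suc κ + j) ∸ (2 * δ + 1)                   ≡⟨ cong (_∸ (2 * δ + 1)) (shift n κ j) ⟩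
  suc (n + κ) + j ∸ (2 * δ + 1)                   ≡⟨ cong (λ m → suc m + j ∸ (2 * δ + 1)) (sym t+u≡n+κ) ⟩
  suc (δ + δ + a + (δ + δ + b)) + j ∸ (2 * δ + 1) ≡⟨ cong (_∸ (2 * δ + 1)) (regroup δ a b j) ⟩
  2 * δ + 1 + (δ + δ + (a + b + j)) ∸ (2 * δ + 1) ≡⟨ m+n∸m≡n (2 * δ + 1) _ ⟩
  δ + δ + (a + b + j)                             ∎
  where
  open ≡-Reasoning
  shift : ∀ n κ j → n + (suc κ + j) ≡ suc (n + κ) + j
  shift = solve-∀
  regroup : ∀ δ a b j → suc (δ + δ + a + (δ + δ + b)) + j ≡ 2 * δ + 1 + (δ + δ + (a + b + j))
  regroup = solve-∀

-- t and u are the orders of the two sides A ∪ S and B ∪ S of a cut S of size κ.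
extremal-sizes : ∀ {n κ k δ t u} → 1 ≤ δ → κ < k → t + u ≡ n + κ → δ + δ ≤ t → δ + δ ≤ u →
  δ * δ + ⌊ n + k ∸ (2 * δ + 1) ²/4⌋ ≤ ⌊ t ²/4⌋ + ⌊ u ²/4⌋ →
  suc κ ≡ k × ((t ≡ δ + δ × u ≡ n + k ∸ (2 * δ + 1)) ⊎ (u ≡ δ + δ × t ≡ n + k ∸ (2 * δ + 1)))
extremal-sizes {n} {κ} {k} {δ} 1≤δ κ<k t+u≡n+κ 2δ≤t 2δ≤u budget
  with m≤n⇒∃[o]m+o≡n 2δ≤t | m≤n⇒∃[o]m+o≡n 2δ≤u | m≤n⇒∃[o]m+o≡n κ<k
... | a , refl | b , refl | j , refl
  with extremal-split δ a b (a + b + j) 1≤δ (m≤m+n (a + b) j)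
         (subst (λ y → δ * δ + ⌊ y ²/4⌋ ≤ ⌊ δ + δ + a ²/4⌋ + ⌊ δ + δ + b ²/4⌋)
                (surplus n κ j δ a b t+u≡n+κ) budget)
... | inj₁ (refl , b≡b+j) with +-cancelˡ-≡ b 0 j (trans (+-identityʳ b) b≡b+j)
...   | refl = sym (+-identityʳ (suc κ)) ,
               inj₁ (+-identityʳ (δ + δ) ,
                     sym (trans (surplus n κ 0 δ 0 b t+u≡n+κ) (cong (δ + δ +_) (+-identityʳ b))))
extremal-sizes {n} {κ} {k} {δ} 1≤δ κ<k t+u≡n+κ 2δ≤t 2δ≤u budget
    | a , refl | b , refl | j , refl | inj₂ (refl , a≡a+j)
  with +-cancelˡ-≡ a 0 j (trans (+-identityʳ a) (trans a≡a+j (cong (_+ j) (+-identityʳ a))))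
...   | refl = sym (+-identityʳ (suc κ)) ,
               inj₂ (+-identityʳ (δ + δ) ,
                     sym (trans (surplus n κ 0 δ a 0 t+u≡n+κ)
                                (cong (δ + δ +_) (trans (+-identityʳ (a + 0)) (+-identityʳ a)))))

squeeze : ∀ {D s t u f g W} → W + W ≤ D → D + s ≡ t + u → t ≤ f + f → u ≤ g + g → f + g ≡ W →
          s ≡ 0 × f + f ≤ t × g + g ≤ u
squeeze {D} {s} {t} {u} {f} {g} {W} 2W≤D D+s≡t+u t≤2f u≤2g f+g≡W =
  s≡0 , +-cancelʳ-≤ (g + g) (f + f) t (≤-trans low (+-monoʳ-≤ t u≤2g)) ,
        +-cancelˡ-≤ (f + f) (g + g) u (≤-trans low (+-monoˡ-≤ u t≤2f))
  where
  open ≤-Reasoning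
  2f+2g≡2W : (f + f) + (g + g) ≡ W + W
  2f+2g≡2W = trans (regroup f g) (cong₂ _+_ f+g≡W f+g≡W)
    where
    regroup : ∀ f g → (f + f) + (g + g) ≡ (f + g) + (f + g)
    regroup = solve-∀
  s≡0 : s ≡ 0
  s≡0 = n≤0⇒n≡0 (+-cancelˡ-≤ D s 0 (begin
    D + s              ≡⟨ D+s≡t+u ⟩
    t + u              ≤⟨ +-mono-≤ t≤2f u≤2g ⟩
    f + f + (g + g)    ≡⟨ 2f+2g≡2W ⟩
    W + W              ≤⟨ 2W≤D ⟩
    D                  ≡⟨ sym (+-identityʳ D) ⟩
    D + 0              ∎))
  low : (f + f) + (g + g) ≤ t + u
  low = begin
    (f + f) + (g + g)  ≡⟨ 2f+2g≡2W ⟩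
    W + W              ≤⟨ 2W≤D ⟩
    D                  ≤⟨ m≤m+n D s ⟩
    D + s              ≡⟨ D+s≡t+u ⟩
    t + u              ∎

m+m≤n+n⇒m≤n : ∀ {m n} → m + m ≤ n + n → m ≤ n
m+m≤n+n⇒m≤n {m} {n} m+m≤n+n with m ≤? n
... | yes m≤n = m≤n
... | no  m≰n = ⊥-elim (<⇒≱ (+-mono-< (≰⇒> m≰n) (≰⇒> m≰n)) m+m≤n+n)

𝟙 : Bool → ℕ
𝟙 b = if b then 1 else 0

𝟙-∧ : ∀ a b → 𝟙 (a ∧ b) ≡ 𝟙 a * 𝟙 b
𝟙-∧ true  b = sym (+-identityʳ (𝟙 b))
𝟙-∧ false b = refl

𝟙-∧-≤ : ∀ a b → 𝟙 (a ∧ b) ≤ 𝟙 a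
𝟙-∧-≤ true  true  = ≤-refl
𝟙-∧-≤ true  false = z≤n
𝟙-∧-≤ false b     = z≤n

𝟙-split : ∀ a b → 𝟙 a ≡ 𝟙 (a ∧ b) + 𝟙 (a ∧ not b)
𝟙-split false b     = refl
𝟙-split true  true  = refl
𝟙-split true  false = refl

∧≡true : ∀ {a b} → a ∧ b ≡ true → a ≡ true × b ≡ true
∧≡true {true} {true} _ = refl , refl

∨≡true : ∀ {a b} → a ∨ b ≡ true → a ≡ true ⊎ b ≡ true
∨≡true {true}          _    = inj₁ refl
∨≡true {false} {true}  _    = inj₂ refl

not-∨≡true : ∀ {a b} → not (a ∨ b) ≡ true → a ≡ false × b ≡ false
not-∨≡true {false} {false} _ = refl , refl

𝟙-∨-disjoint : ∀ a b → (a ≡ true → b ≡ false) → 𝟙 (a ∨ b) ≡ 𝟙 a + 𝟙 b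
𝟙-∨-disjoint true  b     disjoint rewrite disjoint refl = refl
𝟙-∨-disjoint false b     _        = refl

𝟙-not : ∀ b → 𝟙 true ≡ 𝟙 b + 𝟙 (not b)
𝟙-not true  = refl
𝟙-not false = refl

𝟙-complement : ∀ a b → (a ≡ true → b ≡ false) → 𝟙 true ≡ 𝟙 (not (a ∨ b) ∨ b) + 𝟙 a
𝟙-complement true  b     disjoint rewrite disjoint refl = refl
𝟙-complement false true  _ = refl
𝟙-complement false false _ = refl

𝟙-injective : ∀ {a b} → 𝟙 a ≡ 𝟙 b → a ≡ b
𝟙-injective {true}  {true}  _ = refl
𝟙-injective {false} {false} _ = refl

<⇒<ᵇ≡true : ∀ {i j} → i < j → (i <ᵇ j) ≡ true
<⇒<ᵇ≡true i<j = Equivalence.to T-≡ (<⇒<ᵇ i<j)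

≥⇒<ᵇ≡false : ∀ {i j} → j ≤ i → (i <ᵇ j) ≡ false
≥⇒<ᵇ≡false {i} {j} j≤i = ¬-not (λ i<ᵇj → <⇒≱ (<ᵇ⇒< i j (Equivalence.from T-≡ i<ᵇj)) j≤i)

everyVertex : ∀ {n} → Fin n → Bool
everyVertex _ = true

count : ∀ {n} → (Fin n → Bool) → ℕ
count {n} P = ∑[ v < n ] 𝟙 (P v)

count≤n : ∀ {n} (P : Fin n → Bool) → count P ≤ n
count≤n {n} P = ≤-trans (∑-mono-≤ (λ v → 𝟙≤1 (P v))) (≤-reflexive (∑1≡n n))
  where
  𝟙≤1 : ∀ b → 𝟙 b ≤ 1
  𝟙≤1 true  = ≤-refl
  𝟙≤1 false = z≤n

count>0⇒∃ : ∀ {n} (P : Fin n → Bool) → 0 < count P → ∃ λ v → P v ≡ true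
count>0⇒∃ {suc n} P pos with P zero in P0
... | true  = zero , P0
... | false with count>0⇒∃ (P ∘ suc) pos
...   | v , Pv = suc v , Pv

count≥2⇒∃₂ : ∀ {n} (P : Fin n → Bool) → 2 ≤ count P →
             ∃₂ λ u v → u ≢ v × P u ≡ true × P v ≡ true
count≥2⇒∃₂ {suc n} P two with P zero in P0
... | true with count>0⇒∃ (P ∘ suc) (s≤s⁻¹ two)
...   | v , Pv = zero , suc v , (λ ()) , P0 , Pv
count≥2⇒∃₂ {suc n} P two | false with count≥2⇒∃₂ (P ∘ suc) two
...   | u , v , u≢v , Pu , Pv = suc u , suc v , u≢v ∘ Finₚ.suc-injective , Pu , Pv

record SplitsInto {n} (A A₁ A₂ : Fin n → Bool) : Set where
  constructor pointwise
  field at : ∀ v → 𝟙 (A v) ≡ 𝟙 (A₁ v) + 𝟙 (A₂ v)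

count-split : ∀ {n} {A A₁ A₂ : Fin n → Bool} → SplitsInto A A₁ A₂ → count A ≡ count A₁ + count A₂
count-split {A₁ = A₁} {A₂} (pointwise split) =
  trans (sum-cong-≗ split) (∑-distrib-+ (𝟙 ∘ A₁) (𝟙 ∘ A₂))

𝟙-split⇒∨ : ∀ a b c → 𝟙 a ≡ 𝟙 b + 𝟙 c → a ≡ b ∨ c
𝟙-split⇒∨ true  true  c     _  = refl
𝟙-split⇒∨ true  false true  _  = refl
𝟙-split⇒∨ true  false false ()
𝟙-split⇒∨ false true  c     ()
𝟙-split⇒∨ false false true  ()
𝟙-split⇒∨ false false false _  = refl

𝟙-split⇒disjoint : ∀ a b c → 𝟙 a ≡ 𝟙 b + 𝟙 c → b ≡ true → c ≡ false
𝟙-split⇒disjoint a     true  false _  _ = refl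
𝟙-split⇒disjoint true  true  true  () _
𝟙-split⇒disjoint false true  true  () _

splits-swap : ∀ {n} {A A₁ A₂ : Fin n → Bool} → SplitsInto A A₁ A₂ → SplitsInto A A₂ A₁
splits-swap {A₁ = A₁} {A₂} (pointwise split) =
  pointwise (λ v → trans (split v) (+-comm (𝟙 (A₁ v)) (𝟙 (A₂ v))))

count-covered : ∀ {n} (P Q R : Fin n → Bool) → (∀ v → P v ≡ true → Q v ∨ R v ≡ true) →
                count P ≤ count (λ v → Q v ∧ P v) + count R
count-covered P Q R covered =
  ≤-trans (∑-mono-≤ (λ v → termwise (P v) (Q v) (R v) (covered v)))
          (≤-reflexive (∑-distrib-+ (λ v → 𝟙 (Q v ∧ P v)) (λ v → 𝟙 (R v))))
  where
  termwise : ∀ p q r → (p ≡ true → q ∨ r ≡ true) → 𝟙 p ≤ 𝟙 (q ∧ p) + 𝟙 r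
  termwise false q     r     _ = z≤n
  termwise true  true  r     _ = s≤s z≤n
  termwise true  false true  _ = s≤s z≤n
  termwise true  false false h with () ← h refl

count-disjoint-⊆ : ∀ {n} (P₁ P₂ Q : Fin n → Bool) →
                   (∀ v → P₁ v ≡ true → Q v ≡ true) → (∀ v → P₂ v ≡ true → Q v ≡ true) →
                   (∀ v → P₁ v ≡ true → P₂ v ≡ true → ⊥) → count P₁ + count P₂ ≤ count Q
count-disjoint-⊆ P₁ P₂ Q ⊆₁ ⊆₂ disjoint =
  ≤-trans (≤-reflexive (sym (∑-distrib-+ (λ v → 𝟙 (P₁ v)) (λ v → 𝟙 (P₂ v)))))
          (∑-mono-≤ (λ v → termwise (P₁ v) (P₂ v) (Q v) (⊆₁ v) (⊆₂ v) (disjoint v)))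
  where
  termwise : ∀ a b c → (a ≡ true → c ≡ true) → (b ≡ true → c ≡ true) →
             (a ≡ true → b ≡ true → ⊥) → 𝟙 a + 𝟙 b ≤ 𝟙 c
  termwise false false c    _  _  _ = z≤n
  termwise true  false c    ⊆a _  _ rewrite ⊆a refl = s≤s z≤n
  termwise false true  c    _  ⊆b _ rewrite ⊆b refl = s≤s z≤n
  termwise true  true  c    _  _  d with () ← d refl refl

𝟙-∧-split : ∀ a a₁ a₂ e → 𝟙 a ≡ 𝟙 a₁ + 𝟙 a₂ →
            𝟙 (a ∧ e) ≡ 𝟙 (a₁ ∧ e) + 𝟙 (a₂ ∧ e)
𝟙-∧-split a a₁ a₂ e split = begin
  𝟙 (a ∧ e)                          ≡⟨ 𝟙-∧ a e ⟩
  𝟙 a * 𝟙 e                          ≡⟨ cong (_* 𝟙 e) split ⟩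
  (𝟙 a₁ + 𝟙 a₂) * 𝟙 e                ≡⟨ *-distribʳ-+ (𝟙 e) (𝟙 a₁) (𝟙 a₂) ⟩
  𝟙 a₁ * 𝟙 e + 𝟙 a₂ * 𝟙 e            ≡⟨ sym (cong₂ _+_ (𝟙-∧ a₁ e) (𝟙-∧ a₂ e)) ⟩
  𝟙 (a₁ ∧ e) + 𝟙 (a₂ ∧ e)            ∎
  where open ≡-Reasoning

∧-left-comm : ∀ a b c → a ∧ (b ∧ c) ≡ b ∧ (a ∧ c)
∧-left-comm true  b c = refl
∧-left-comm false b c = sym (∧-zeroʳ b)

module _ {n : ℕ} (G : Graph n) where

  degreeIn : (Fin n → Bool) → Fin n → ℕ
  degreeIn B u = ∑[ w < n ] 𝟙 (B w ∧ adj G u w)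

  -- Ordered pairs of adjacent vertices, so arcs P P = 2 e(G[P]).
  arcs : (Fin n → Bool) → (Fin n → Bool) → ℕ
  arcs A B = ∑[ u < n ] (𝟙 (A u) * degreeIn B u)

  degree≡degreeIn : ∀ v → degree G v ≡ degreeIn everyVertex v
  degree≡degreeIn v = sum-map-allFin (λ u → 𝟙 (adj G v u))

  degreeIn-split : ∀ {B B₁ B₂} → SplitsInto B B₁ B₂ →
                   ∀ u → degreeIn B u ≡ degreeIn B₁ u + degreeIn B₂ u
  degreeIn-split {B} {B₁} {B₂} (pointwise split) u = trans
    (sum-cong-≗ (λ w → 𝟙-∧-split (B w) (B₁ w) (B₂ w) (adj G u w) (split w)))
    (∑-distrib-+ (λ w → 𝟙 (B₁ w ∧ adj G u w)) (λ w → 𝟙 (B₂ w ∧ adj G u w)))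

  arcs-splitˡ : ∀ {A A₁ A₂} B → SplitsInto A A₁ A₂ → arcs A B ≡ arcs A₁ B + arcs A₂ B
  arcs-splitˡ {A₁ = A₁} {A₂} B (pointwise split) = trans
    (sum-cong-≗ (λ u → trans (cong (_* degreeIn B u) (split u))
                             (*-distribʳ-+ (degreeIn B u) (𝟙 (A₁ u)) _)))
    (∑-distrib-+ (λ u → 𝟙 (A₁ u) * degreeIn B u) (λ u → 𝟙 (A₂ u) * degreeIn B u))

  arcs-splitʳ : ∀ A {B B₁ B₂} → SplitsInto B B₁ B₂ → arcs A B ≡ arcs A B₁ + arcs A B₂
  arcs-splitʳ A {B₁ = B₁} {B₂} sp = trans
    (sum-cong-≗ (λ u → trans (cong (𝟙 (A u) *_) (degreeIn-split sp u))
                             (*-distribˡ-+ (𝟙 (A u)) (degreeIn B₁ u) _)))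
    (∑-distrib-+ (λ u → 𝟙 (A u) * degreeIn B₁ u) (λ u → 𝟙 (A u) * degreeIn B₂ u))

  arcs≡∑∑ : ∀ A B → arcs A B ≡ ∑[ u < n ] ∑[ w < n ] 𝟙 (A u ∧ (B w ∧ adj G u w))
  arcs≡∑∑ A B = sum-cong-≗ (λ u →
    trans (*-distribˡ-sum (𝟙 (A u)) (λ w → 𝟙 (B w ∧ adj G u w)))
          (sum-cong-≗ (λ w → sym (𝟙-∧ (A u) (B w ∧ adj G u w)))))

  arcs-comm : ∀ A B → arcs A B ≡ arcs B A
  arcs-comm A B = begin
    arcs A B
      ≡⟨ arcs≡∑∑ A B ⟩
    ∑[ u < n ] ∑[ w < n ] 𝟙 (A u ∧ (B w ∧ adj G u w))
      ≡⟨ ∑-comm (λ u w → 𝟙 (A u ∧ (B w ∧ adj G u w))) ⟩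
    ∑[ w < n ] ∑[ u < n ] 𝟙 (A u ∧ (B w ∧ adj G u w))
      ≡⟨ sum-cong-≗ (λ w → sum-cong-≗ (λ u → cong 𝟙 (reverse (A u) (B w) u w))) ⟩
    ∑[ w < n ] ∑[ u < n ] 𝟙 (B w ∧ (A u ∧ adj G w u))
      ≡⟨ sym (arcs≡∑∑ B A) ⟩
    arcs B A
      ∎
    where
    open ≡-Reasoning
    reverse : ∀ a b u w → a ∧ (b ∧ adj G u w) ≡ b ∧ (a ∧ adj G w u)
    reverse a b u w = trans (∧-left-comm a b _) (cong (λ e → b ∧ (a ∧ e)) (Graph.sym G u w))

  degreeIn≡0 : ∀ {B u} → (∀ w → B w ≡ true → adj G u w ≡ false) → degreeIn B u ≡ 0
  degreeIn≡0 {B} {u} none = trans (sum-cong-≗ term≡0) (sum-replicate-zero n)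
    where
    term≡0 : ∀ w → 𝟙 (B w ∧ adj G u w) ≡ 0
    term≡0 w with B w in Bw
    ... | false = refl
    ... | true  = cong 𝟙 (none w Bw)

  degreeIn≡count⇒adjacent : ∀ {B u} → degreeIn B u ≡ count B → ∀ w → B w ≡ true → adj G u w ≡ true
  degreeIn≡count⇒adjacent {B} {u} full w Bw =
    𝟙-∧≡𝟙⇒≡true (B w) (adj G u w) Bw
      (≤-pointwise∧∑≥⇒≡ _ _ (λ w → 𝟙-∧-≤ (B w) (adj G u w)) (≤-reflexive (sym full)) w)
    where
    𝟙-∧≡𝟙⇒≡true : ∀ a b → a ≡ true → 𝟙 (a ∧ b) ≡ 𝟙 a → b ≡ true
    𝟙-∧≡𝟙⇒≡true true true  _ _ = refl
    𝟙-∧≡𝟙⇒≡true true false _ ()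

  arcs≡0 : ∀ {A B} → (∀ u w → A u ≡ true → B w ≡ true → adj G u w ≡ false) → arcs A B ≡ 0
  arcs≡0 {A} {B} none = trans (sum-cong-≗ term≡0) (sum-replicate-zero n)
    where
    term≡0 : ∀ u → 𝟙 (A u) * degreeIn B u ≡ 0
    term≡0 u with A u in Au
    ... | false = refl
    ... | true  = trans (+-identityʳ _) (degreeIn≡0 (λ w Bw → none u w Au Bw))

  arcs≡0⇒nonadjacent : ∀ {A B} → arcs A B ≡ 0 → ∀ u w → A u ≡ true → B w ≡ true → adj G u w ≡ false
  arcs≡0⇒nonadjacent {A} {B} zero-arcs u w Au Bw with adj G u w in uw
  ... | false = refl
  ... | true  = ⊥-elim (1+n≢0 (begin
    1                            ≡⟨ cong 𝟙 (sym (trans (cong₂ (λ a b → a ∧ (b ∧ adj G u w)) Au Bw) uw)) ⟩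
    𝟙 (A u ∧ (B w ∧ adj G u w))  ≡⟨ ∑≡0⇒≡0 _ (∑≡0⇒≡0 _ (trans (sym (arcs≡∑∑ A B)) zero-arcs) u) w ⟩
    0                            ∎))
    where open ≡-Reasoning

  private
    weighted-≤ : ∀ {A B : Fin n → Bool} {Δ} → (∀ u → A u ≡ true → degreeIn B u ≤ Δ) →
                 ∀ u → 𝟙 (A u) * degreeIn B u ≤ 𝟙 (A u) * Δ
    weighted-≤ {A} bounded u with A u in Au
    ... | false = z≤n
    ... | true  = +-monoˡ-≤ 0 (bounded u Au)

  arcs≤count*Δ : ∀ {A B Δ} → (∀ u → A u ≡ true → degreeIn B u ≤ Δ) → arcs A B ≤ count A * Δ
  arcs≤count*Δ {A} {B} {Δ} bounded =
    ≤-trans (∑-mono-≤ (weighted-≤ bounded)) (≤-reflexive (sym (*-distribʳ-sum Δ (𝟙 ∘ A))))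

  arcs≥count*Δ⇒degreeIn≡Δ : ∀ {A B Δ} → (∀ u → A u ≡ true → degreeIn B u ≤ Δ) →
                             count A * Δ ≤ arcs A B → ∀ u → A u ≡ true → degreeIn B u ≡ Δ
  arcs≥count*Δ⇒degreeIn≡Δ {A} {B} {Δ} bounded tight u Au = begin
    degreeIn B u              ≡⟨ sym (+-identityʳ _) ⟩
    1 * degreeIn B u          ≡⟨ cong (λ a → 𝟙 a * degreeIn B u) (sym Au) ⟩
    𝟙 (A u) * degreeIn B u    ≡⟨ ≤-pointwise∧∑≥⇒≡ _ _ (weighted-≤ bounded)
                                   (≤-trans (≤-reflexive (sym (*-distribʳ-sum Δ (𝟙 ∘ A)))) tight) u ⟩
    𝟙 (A u) * Δ               ≡⟨ cong (λ a → 𝟙 a * Δ) Au ⟩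
    1 * Δ                     ≡⟨ +-identityʳ Δ ⟩
    Δ                         ∎
    where open ≡-Reasoning

  handshake : arcs everyVertex everyVertex ≡ size G + size G
  handshake = begin
    arcs everyVertex everyVertex
      ≡⟨ sum-cong-≗ (λ u → +-identityʳ (degreeIn everyVertex u)) ⟩
    ∑[ u < n ] ∑[ v < n ] 𝟙 (adj G u v)
      ≡⟨ sum-cong-≗ (λ u → sum-cong-≗ (λ v → orient u v)) ⟩
    ∑[ u < n ] ∑[ v < n ] (oriented u v + oriented v u)
      ≡⟨ sum-cong-≗ (λ u → ∑-distrib-+ (oriented u) (λ v → oriented v u)) ⟩
    ∑[ u < n ] (∑[ v < n ] oriented u v + ∑[ v < n ] oriented v u)
      ≡⟨ ∑-distrib-+ (λ u → ∑[ v < n ] oriented u v) (λ u → ∑[ v < n ] oriented v u) ⟩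
    ∑[ u < n ] ∑[ v < n ] oriented u v + ∑[ u < n ] ∑[ v < n ] oriented v u
      ≡⟨ cong (∑[ u < n ] ∑[ v < n ] oriented u v +_) (∑-comm (λ u v → oriented v u)) ⟩
    ∑[ u < n ] ∑[ v < n ] oriented u v + ∑[ v < n ] ∑[ u < n ] oriented v u
      ≡⟨ sym (cong₂ _+_ size≡∑∑ size≡∑∑) ⟩
    size G + size G ∎
    where
    open ≡-Reasoning
    oriented : Fin n → Fin n → ℕ
    oriented u v = 𝟙 (adj G u v ∧ (toℕ u <ᵇ toℕ v))

    size≡∑∑ : size G ≡ ∑[ u < n ] ∑[ v < n ] oriented u v
    size≡∑∑ = trans (sum-map-allFin (λ u → sumˡ (List.map (oriented u) (List.allFin n))))
                    (sum-cong-≗ (λ u → sum-map-allFin (oriented u)))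

    orient : ∀ u v → 𝟙 (adj G u v) ≡ oriented u v + oriented v u
    orient u v with <-cmp (toℕ u) (toℕ v)
    ... | tri< u<v _ _ rewrite <⇒<ᵇ≡true u<v | ≥⇒<ᵇ≡false (<⇒≤ u<v)
                             | ∧-identityʳ (adj G u v) | ∧-zeroʳ (adj G v u) = sym (+-identityʳ _)
    ... | tri> _ _ v<u rewrite ≥⇒<ᵇ≡false (<⇒≤ v<u) | <⇒<ᵇ≡true v<u
                             | ∧-zeroʳ (adj G u v) | ∧-identityʳ (adj G v u) | Graph.sym G u v = refl
    ... | tri≈ _ u≡v _ with Finₚ.toℕ-injective u≡v
    ...   | refl rewrite Graph.irrefl G u = refl

-- Mantel's theorem and its equality case

∃-max : ∀ {n} (f : Fin n → ℕ) → Fin n → ∃ λ x → ∀ v → f v ≤ f x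
∃-max {n} f x₀ = argmax f x₀ (List.allFin n) , λ v →
  v≤f[argmax]⁺ x₀ (List.allFin n) (inj₂ (Any.map (λ { refl → ≤-refl }) (∈-allFin v)))

module _ {n : ℕ} (G : Graph n) where

  record BalancedBipartition (P : Fin n → Bool) : Set where
    field
      left right        : Fin n → Bool
      splits            : SplitsInto P left right
      left-independent  : ∀ u w → left u ≡ true → left w ≡ true → adj G u w ≡ false
      right-independent : ∀ u w → right u ≡ true → right w ≡ true → adj G u w ≡ false
      complete          : ∀ u w → left u ≡ true → right w ≡ true → adj G u w ≡ true
      left-size         : count left ≡ ⌈ count P /2⌉
      right-size        : count right ≡ ⌊ count P /2⌋

  -- If x has the largest degree into P, then N = P ∩ N(x) is independent, so every edge of G[P]
  -- has an end in R = P ∖ N, and e(G[P]) ≤ Σ_{u ∈ R} deg_P u ≤ |R| |N| ≤ ⌊|P|²/4⌋.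
  module MaxDegreeSplit (triangle-free : TriangleFree G) (P : Fin n → Bool) (x : Fin n)
                        (x-max : ∀ v → degreeIn G P v ≤ degreeIn G P x) where

    N R : Fin n → Bool
    N v = P v ∧ adj G x v
    R v = P v ∧ not (adj G x v)

    Δ : ℕ
    Δ = count N

    P-splits : SplitsInto P N R
    P-splits = pointwise (λ v → 𝟙-split (P v) (adj G x v))

    count-R+Δ : count R + Δ ≡ count P
    count-R+Δ = trans (+-comm (count R) Δ) (sym (count-split P-splits))

    N-independent : ∀ u w → N u ≡ true → N w ≡ true → adj G u w ≡ false
    N-independent u w Nu Nw with adj G u w in uw
    ... | false = refl
    ... | true  with ∧≡true Nu | ∧≡true Nw
    ...   | _ , xu | _ , xw with () ← triangle-free x u w xu uw xw

    R-degreeIn≤Δ : ∀ u → R u ≡ true → degreeIn G P u ≤ Δ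
    R-degreeIn≤Δ u _ = x-max u

    arcs-P≡ : arcs G P P ≡ arcs G R N + arcs G R N + arcs G R R
    arcs-P≡ = begin
      arcs G P P                              ≡⟨ arcs-splitˡ G P P-splits ⟩
      arcs G N P + arcs G R P                 ≡⟨ cong₂ _+_ (arcs-splitʳ G N P-splits) (arcs-splitʳ G R P-splits) ⟩
      arcs G N N + arcs G N R + (arcs G R N + arcs G R R)
        ≡⟨ cong₂ (λ a b → a + b + (arcs G R N + arcs G R R)) (arcs≡0 G N-independent) (arcs-comm G N R) ⟩
      0 + arcs G R N + (arcs G R N + arcs G R R) ≡⟨ sym (+-assoc (arcs G R N) _ _) ⟩
      arcs G R N + arcs G R N + arcs G R R    ∎
      where open ≡-Reasoning

    arcs-R-P≡ : arcs G R P ≡ arcs G R N + arcs G R R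
    arcs-R-P≡ = arcs-splitʳ G R P-splits

    arcs-R-P≤ : arcs G R P ≤ ⌊ count P ²/4⌋
    arcs-R-P≤ = begin
      arcs G R P              ≤⟨ arcs≤count*Δ G R-degreeIn≤Δ ⟩
      count R * Δ             ≤⟨ m*n≤⌊[m+n]²/4⌋ (count R) Δ ⟩
      ⌊ count R + Δ ²/4⌋      ≡⟨ cong ⌊_²/4⌋ count-R+Δ ⟩
      ⌊ count P ²/4⌋          ∎
      where open ≤-Reasoning

    arcs-P≤ : arcs G P P ≤ arcs G R P + arcs G R P
    arcs-P≤ = begin
      arcs G P P                                          ≡⟨ arcs-P≡ ⟩
      arcs G R N + arcs G R N + arcs G R R                ≤⟨ +-monoʳ-≤ _ (m≤n+m (arcs G R R) (arcs G R R)) ⟩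
      arcs G R N + arcs G R N + (arcs G R R + arcs G R R) ≡⟨ regroup (arcs G R N) (arcs G R R) ⟩
      (arcs G R N + arcs G R R) + (arcs G R N + arcs G R R) ≡⟨ sym (cong₂ _+_ arcs-R-P≡ arcs-R-P≡) ⟩
      arcs G R P + arcs G R P                             ∎
      where
      open ≤-Reasoning
      regroup : ∀ e r → e + e + (r + r) ≡ (e + r) + (e + r)
      regroup = solve-∀

    module Tight (tight : ⌊ count P ²/4⌋ + ⌊ count P ²/4⌋ ≤ arcs G P P) where

      arcs-R-R≡0 : arcs G R R ≡ 0
      arcs-R-R≡0 = n≤0⇒n≡0 (+-cancelˡ-≤ (arcs G R N + arcs G R N + arcs G R R) _ _ (begin
        arcs G R N + arcs G R N + arcs G R R + arcs G R R   ≡⟨ regroup (arcs G R N) (arcs G R R) ⟩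
        (arcs G R N + arcs G R R) + (arcs G R N + arcs G R R) ≡⟨ sym (cong₂ _+_ arcs-R-P≡ arcs-R-P≡) ⟩
        arcs G R P + arcs G R P                             ≤⟨ +-mono-≤ arcs-R-P≤ arcs-R-P≤ ⟩
        ⌊ count P ²/4⌋ + ⌊ count P ²/4⌋                     ≤⟨ tight ⟩
        arcs G P P                                          ≡⟨ arcs-P≡ ⟩
        arcs G R N + arcs G R N + arcs G R R                ≡⟨ sym (+-identityʳ _) ⟩
        arcs G R N + arcs G R N + arcs G R R + 0            ∎))
        where
        open ≤-Reasoning
        regroup : ∀ e r → e + e + r + r ≡ (e + r) + (e + r)
        regroup = solve-∀

      ⌊p²/4⌋≤arcs-R-P : ⌊ count P ²/4⌋ ≤ arcs G R P
      ⌊p²/4⌋≤arcs-R-P = m+m≤n+n⇒m≤n (≤-trans tight arcs-P≤)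

      R-independent : ∀ u w → R u ≡ true → R w ≡ true → adj G u w ≡ false
      R-independent = arcs≡0⇒nonadjacent G arcs-R-R≡0

      R-complete-to-N : ∀ u w → R u ≡ true → N w ≡ true → adj G u w ≡ true
      R-complete-to-N u w Ru = degreeIn≡count⇒adjacent G (begin
        degreeIn G N u                       ≡⟨ sym (+-identityʳ _) ⟩
        degreeIn G N u + 0                   ≡⟨ cong (degreeIn G N u +_) (sym no-R-neighbour) ⟩
        degreeIn G N u + degreeIn G R u      ≡⟨ sym (degreeIn-split G P-splits u) ⟩
        degreeIn G P u                       ≡⟨ full-degree ⟩
        Δ                                    ∎) w
        where
        open ≡-Reasoning
        no-R-neighbour : degreeIn G R u ≡ 0
        no-R-neighbour = degreeIn≡0 G (λ w → R-independent u w Ru)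
        full-degree : degreeIn G P u ≡ Δ
        full-degree = arcs≥count*Δ⇒degreeIn≡Δ G R-degreeIn≤Δ
          (≤-trans (m*n≤⌊[m+n]²/4⌋ (count R) Δ)
                   (≤-trans (≤-reflexive (cong ⌊_²/4⌋ count-R+Δ)) ⌊p²/4⌋≤arcs-R-P)) u Ru

      balanced : Balanced (count R) Δ
      balanced = ⌊[m+n]²/4⌋≤m*n⇒Balanced (count R) Δ (begin
        ⌊ count R + Δ ²/4⌋  ≡⟨ cong ⌊_²/4⌋ count-R+Δ ⟩
        ⌊ count P ²/4⌋      ≤⟨ ⌊p²/4⌋≤arcs-R-P ⟩
        arcs G R P          ≤⟨ arcs≤count*Δ G R-degreeIn≤Δ ⟩
        count R * Δ         ∎)
        where open ≤-Reasoning

      bipartition : BalancedBipartition P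
      bipartition with balanced
      ... | inj₁ (R≡⌈⌉ , Δ≡⌊⌋) = record
        { left = R ; right = N ; splits = splits-swap P-splits
        ; left-independent = R-independent ; right-independent = N-independent
        ; complete = R-complete-to-N
        ; left-size = trans R≡⌈⌉ (cong ⌈_/2⌉ count-R+Δ)
        ; right-size = trans Δ≡⌊⌋ (cong ⌊_/2⌋ count-R+Δ) }
      ... | inj₂ (R≡⌊⌋ , Δ≡⌈⌉) = record
        { left = N ; right = R ; splits = P-splits
        ; left-independent = N-independent ; right-independent = R-independent
        ; complete = λ u w Nu Rw → trans (Graph.sym G u w) (R-complete-to-N w u Rw Nu)
        ; left-size = trans Δ≡⌈⌉ (cong ⌈_/2⌉ count-R+Δ)
        ; right-size = trans R≡⌊⌋ (cong ⌊_/2⌋ count-R+Δ) }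

  -- The vertex argument only witnesses that G is nonempty.
  mantel : TriangleFree G → Fin n → ∀ P → arcs G P P ≤ ⌊ count P ²/4⌋ + ⌊ count P ²/4⌋
  mantel triangle-free x₀ P with ∃-max (degreeIn G P) x₀
  ... | x , x-max = ≤-trans arcs-P≤ (+-mono-≤ arcs-R-P≤ arcs-R-P≤)
    where open MaxDegreeSplit triangle-free P x x-max

  mantel-equality : TriangleFree G → Fin n → ∀ P →
                    ⌊ count P ²/4⌋ + ⌊ count P ²/4⌋ ≤ arcs G P P → BalancedBipartition P
  mantel-equality triangle-free x₀ P tight with ∃-max (degreeIn G P) x₀
  ... | x , x-max = Tight.bipartition tight
    where open MaxDegreeSplit triangle-free P x x-max

-- The component of a vertex in G − S

lookup≡false⇒∈∁ : ∀ {n} (S : Subset n) {v} → lookup S v ≡ false → v ∈ ∁ S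
lookup≡false⇒∈∁ S Sv≡false =
  x∉p⇒x∈∁p (λ v∈S → contradiction (trans (sym ([]=⇒lookup v∈S)) Sv≡false) λ ())

∈∁⇒lookup≡false : ∀ {n} (S : Subset n) {v} → v ∈ ∁ S → lookup S v ≡ false
∈∁⇒lookup≡false S {v} v∈∁S with lookup S v in Sv
... | false = refl
... | true  = contradiction (lookup⇒[]= v S Sv) (x∈∁p⇒x∉p v∈∁S)

module _ {n : ℕ} (G : Graph n) where

  reach-end : ∀ {R u w} → Reach G R u w → w ∈ R
  reach-end (here w∈R)       = w∈R
  reach-end (step _ _ reach) = reach-end reach

  reach-snoc : ∀ {R u w z} → Reach G R u w → Adj G w z → z ∈ R → Reach G R u z
  reach-snoc (here w∈R)          wz z∈R = step w∈R wz (here z∈R)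
  reach-snoc (step u∈R uv reach) wz z∈R = step u∈R uv (reach-snoc reach wz z∈R)

  ClosedOutside : Subset n → (Fin n → Bool) → Set
  ClosedOutside S A = ∀ w z → A w ≡ true → adj G w z ≡ true → lookup S z ≡ false → A z ≡ true

  module Closure (S : Subset n) (u₀ : Fin n) where

    hasNeighbourIn : (R : Fin n → Bool) (v : Fin n) → Dec (∃ λ w → R w ∧ adj G w v ≡ true)
    hasNeighbourIn R v = any? (λ w → R w ∧ adj G w v ≟ᵇ true)

    grow : (Fin n → Bool) → Fin n → Bool
    grow R v = R v ∨ (not (lookup S v) ∧ does (hasNeighbourIn R v))

    -- n iterations suffice, as each step that does not stop adds a vertex.
    closure : ℕ → (Fin n → Bool) → Fin n → Bool
    closure zero    R = R
    closure (suc f) R with count (grow R) ≟ count R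
    ... | yes _ = R
    ... | no  _ = closure f (grow R)

    grow-⊇ : ∀ R v → R v ≡ true → grow R v ≡ true
    grow-⊇ R v Rv rewrite Rv = refl

    𝟙-grow-⊇ : ∀ R v → 𝟙 (R v) ≤ 𝟙 (grow R v)
    𝟙-grow-⊇ R v with R v in Rv
    ... | true  = ≤-refl
    ... | false = z≤n

    closure-⊇ : ∀ f R v → R v ≡ true → closure f R v ≡ true
    closure-⊇ zero    R v Rv = Rv
    closure-⊇ (suc f) R v Rv with count (grow R) ≟ count R
    ... | yes _ = Rv
    ... | no  _ = closure-⊇ f (grow R) v (grow-⊇ R v Rv)

    Reachable : (Fin n → Bool) → Set
    Reachable R = ∀ v → R v ≡ true → Reach G (∁ S) u₀ v

    grow-reachable : ∀ R → Reachable R → Reachable (grow R)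
    grow-reachable R reachable v growRv with R v in Rv | lookup S v in Sv | hasNeighbourIn R v
    ... | true  | _     | _ = reachable v Rv
    ... | false | false | yes (w , Rw∧wv) with ∧≡true Rw∧wv
    ...   | Rw , wv = reach-snoc (reachable w Rw) wv (lookup≡false⇒∈∁ S Sv)

    closure-reachable : ∀ f R → Reachable R → Reachable (closure f R)
    closure-reachable zero    R reachable = reachable
    closure-reachable (suc f) R reachable with count (grow R) ≟ count R
    ... | yes _ = reachable
    ... | no  _ = closure-reachable f (grow R) (grow-reachable R reachable)

    stable⇒closed : ∀ R → count (grow R) ≡ count R → ClosedOutside S R
    stable⇒closed R stable w z Rw wz Sz = 𝟙-injective (trans
      (≤-pointwise∧∑≥⇒≡ _ _ (𝟙-grow-⊇ R) (≤-reflexive stable) z) (cong 𝟙 grows))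
      where
      grows : grow R z ≡ true
      grows rewrite Sz with hasNeighbourIn R z
      ... | yes _ = ∨-zeroʳ (R z)
      ... | no  none = contradiction (w , cong₂ _∧_ Rw wz) none

    closure-closed : ∀ f R → n < f + count R → ClosedOutside S (closure f R)
    closure-closed zero    R n<R = ⊥-elim (<⇒≱ n<R (count≤n R))
    closure-closed (suc f) R n<f+R with count (grow R) ≟ count R
    ... | yes stable = stable⇒closed R stable
    ... | no  grew   = closure-closed f (grow R) (≤-trans n<f+R (begin
      suc f + count R     ≡⟨ sym (+-suc f (count R)) ⟩
      f + suc (count R)   ≤⟨ +-monoʳ-≤ f (≤∧≢⇒< (∑-mono-≤ (𝟙-grow-⊇ R)) (grew ∘ sym)) ⟩
      f + count (grow R)  ∎))
      where open ≤-Reasoning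

  component : (S : Subset n) (u₀ : Fin n) → u₀ ∈ ∁ S →
    ∃ λ A → A u₀ ≡ true × (∀ v → A v ≡ true → Reach G (∁ S) u₀ v) × ClosedOutside S A
  component S u₀ u₀∈∁S = closure n seed , closure-⊇ n seed u₀ seed-u₀ ,
    closure-reachable n seed seed-reachable , closure-closed n seed n<n+∣seed∣
    where
    open Closure S u₀
    seed : Fin n → Bool
    seed v = does (v ≟ᶠ u₀)
    seed-u₀ : seed u₀ ≡ true
    seed-u₀ with u₀ ≟ᶠ u₀
    ... | yes _   = refl
    ... | no  u≢u = contradiction refl u≢u
    seed-reachable : Reachable seed
    seed-reachable v _ with v ≟ᶠ u₀
    seed-reachable v _ | yes refl = here u₀∈∁S
    n<n+∣seed∣ : n < n + count seed
    n<n+∣seed∣ = begin-strict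
      n               ≡⟨ sym (+-identityʳ n) ⟩
      n + 0           <⟨ +-monoʳ-< n (subst (_≤ count seed) (cong 𝟙 seed-u₀) (f≤∑f (𝟙 ∘ seed) u₀)) ⟩
      n + count seed  ∎
      where open ≤-Reasoning

-- The two sides of a vertex-cut

-- A vertex w₀ ∈ C has a neighbour z ∈ C, as s is too small to hold all neighbours of w₀; the
-- neighbourhoods of w₀ and z are disjoint, G being triangle-free, and both lie in C ∪ s.
closed-side≥2δ : ∀ {n} (G : Graph n) → TriangleFree G → ∀ {δ} → (∀ v → δ ≤ degree G v) →
  (s C : Fin n → Bool) → count s < δ → (∀ w z → C w ≡ true → adj G w z ≡ true → C z ∨ s z ≡ true) →
  ∀ w₀ → C w₀ ≡ true → δ + δ ≤ count (λ v → C v ∨ s v)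
closed-side≥2δ G triangle-free {δ} min-degree s C s<δ closed w₀ Cw₀
  with count>0⇒∃ (λ v → C v ∧ adj G w₀ v) C-neighbour
  where
  C-neighbour : 0 < degreeIn G C w₀
  C-neighbour with degreeIn G C w₀ in d≡0
  ... | suc _ = s≤s z≤n
  ... | zero  = contradiction (begin
    δ                         ≤⟨ min-degree w₀ ⟩
    degree G w₀               ≡⟨ degree≡degreeIn G w₀ ⟩
    count (adj G w₀)          ≤⟨ count-covered (adj G w₀) C s (λ v → closed w₀ v Cw₀) ⟩
    degreeIn G C w₀ + count s ≡⟨ cong (_+ count s) d≡0 ⟩
    count s                   ∎) (<⇒≱ s<δ)
    where open ≤-Reasoning
... | z , Cz∧w₀z with ∧≡true Cz∧w₀z
...   | Cz , w₀z = begin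
  δ + δ                              ≤⟨ +-mono-≤ (min-degree w₀) (min-degree z) ⟩
  degree G w₀ + degree G z           ≡⟨ cong₂ _+_ (degree≡degreeIn G w₀) (degree≡degreeIn G z) ⟩
  count (adj G w₀) + count (adj G z) ≤⟨ count-disjoint-⊆ (adj G w₀) (adj G z) _
                                          (λ v → closed w₀ v Cw₀) (λ v → closed z v Cz)
                                          (λ v w₀v zv → triangle-free w₀ z v w₀z zv w₀v) ⟩
  count (λ v → C v ∨ s v)            ∎
  where open ≤-Reasoning

module CutSides {n : ℕ} (G : Graph n) (S : Subset n) (A : Fin n → Bool)
                (A-avoids-S : ∀ v → A v ≡ true → lookup S v ≡ false)
                (A-closed : ClosedOutside G S A) where

  inS B T U : Fin n → Bool
  inS = lookup S
  B v = not (A v ∨ inS v)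
  T v = A v ∨ inS v
  U v = B v ∨ inS v

  A-B-nonadjacent : ∀ u w → A u ≡ true → B w ≡ true → adj G u w ≡ false
  A-B-nonadjacent u w Au Bw with not-∨≡true Bw | adj G u w in uw
  ... | _ , _ | false = refl
  ... | Aw≡false , Sw≡false | true with () ← trans (sym (A-closed u w Au uw Sw≡false)) Aw≡false

  B-A-nonadjacent : ∀ u w → B u ≡ true → A w ≡ true → adj G u w ≡ false
  B-A-nonadjacent u w Bu Aw = trans (Graph.sym G u w) (A-B-nonadjacent w u Aw Bu)

  A-side-closed : ∀ w z → A w ≡ true → adj G w z ≡ true → A z ∨ inS z ≡ true
  A-side-closed w z Aw wz with inS z in Sz
  ... | true  = ∨-zeroʳ (A z)
  ... | false rewrite A-closed w z Aw wz Sz = refl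

  B-side-closed : ∀ w z → B w ≡ true → adj G w z ≡ true → B z ∨ inS z ≡ true
  B-side-closed w z Bw wz with inS z in Sz | A z in Az
  ... | true  | a     = ∨-zeroʳ (not (a ∨ true))
  ... | false | false = refl
  ... | false | true  with () ← trans (sym wz) (B-A-nonadjacent w z Bw Az)

  V-splits : SplitsInto everyVertex T B
  V-splits = pointwise (λ v → 𝟙-not (T v))

  V-splits′ : SplitsInto everyVertex U A
  V-splits′ = pointwise (λ v → 𝟙-complement (A v) (inS v) (A-avoids-S v))

  T-splits : SplitsInto T A inS
  T-splits = pointwise (λ v → 𝟙-∨-disjoint (A v) (inS v) (A-avoids-S v))

  U-splits : SplitsInto U B inS
  U-splits = pointwise (λ v → 𝟙-∨-disjoint (B v) (inS v) (λ Bv → proj₂ (not-∨≡true Bv)))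

  count-T+U : count T + count U ≡ n + count inS
  count-T+U = begin
    count T + count U                  ≡⟨ cong (count T +_) (count-split U-splits) ⟩
    count T + (count B + count inS)    ≡⟨ sym (+-assoc (count T) (count B) (count inS)) ⟩
    count T + count B + count inS      ≡⟨ cong (_+ count inS) (sym (count-split V-splits)) ⟩
    count {n} everyVertex + count inS  ≡⟨ cong (_+ count inS) (∑1≡n n) ⟩
    n + count inS                      ∎
    where open ≡-Reasoning

  arcs-V+S≡arcs-T+U : arcs G everyVertex everyVertex + arcs G inS inS ≡ arcs G T T + arcs G U U
  arcs-V+S≡arcs-T+U = begin
    arcs G everyVertex everyVertex + arcs G inS inS
      ≡⟨ cong (_+ arcs G inS inS) (trans (arcs-splitˡ G everyVertex V-splits)
           (cong₂ _+_ (arcs-splitʳ G T V-splits) (arcs-splitʳ G B V-splits))) ⟩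
    arcs G T T + arcs G T B + (arcs G B T + arcs G B B) + arcs G inS inS
      ≡⟨ cong₂ (λ x y → arcs G T T + x + (y + arcs G B B) + arcs G inS inS) T-B≡ B-T≡ ⟩
    arcs G T T + arcs G inS B + (arcs G B inS + arcs G B B) + arcs G inS inS
      ≡⟨ regroup (arcs G T T) (arcs G inS B) (arcs G B inS) (arcs G B B) (arcs G inS inS) ⟩
    arcs G T T + (arcs G B B + arcs G B inS + (arcs G inS B + arcs G inS inS))
      ≡⟨ cong (arcs G T T +_) (sym U-U≡) ⟩
    arcs G T T + arcs G U U ∎
    where
    open ≡-Reasoning
    T-B≡ : arcs G T B ≡ arcs G inS B
    T-B≡ = trans (arcs-splitˡ G B T-splits) (cong (_+ arcs G inS B) (arcs≡0 G A-B-nonadjacent))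
    B-T≡ : arcs G B T ≡ arcs G B inS
    B-T≡ = trans (arcs-splitʳ G B T-splits) (cong (_+ arcs G B inS) (arcs≡0 G B-A-nonadjacent))
    U-U≡ : arcs G U U ≡ arcs G B B + arcs G B inS + (arcs G inS B + arcs G inS inS)
    U-U≡ = trans (arcs-splitˡ G U U-splits) (cong₂ _+_ (arcs-splitʳ G B U-splits) (arcs-splitʳ G inS U-splits))
    regroup : ∀ tt sb bs bb ss → tt + sb + (bs + bb) + ss ≡ tt + (bb + bs + (sb + ss))
    regroup = solve-∀

-- Induced empty and complete bipartite subgraphs

enumerate : ∀ {n} (p : Subset n) → Fin ∣ p ∣ → Fin n
enumerate (true  ∷ p) zero    = zero
enumerate (true  ∷ p) (suc i) = suc (enumerate p i)
enumerate (false ∷ p) i       = suc (enumerate p i)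

enumerate-∈ : ∀ {n} (p : Subset n) i → lookup p (enumerate p i) ≡ true
enumerate-∈ (true  ∷ p) zero    = refl
enumerate-∈ (true  ∷ p) (suc i) = enumerate-∈ p i
enumerate-∈ (false ∷ p) i       = enumerate-∈ p i

enumerate-injective : ∀ {n} (p : Subset n) {i j} → enumerate p i ≡ enumerate p j → i ≡ j
enumerate-injective (true  ∷ p) {zero}  {zero}  _  = refl
enumerate-injective (true  ∷ p) {suc i} {suc j} eq = cong suc (enumerate-injective p (Finₚ.suc-injective eq))
enumerate-injective (false ∷ p)                 eq = enumerate-injective p (Finₚ.suc-injective eq)

enumerate-surjective : ∀ {n} (p : Subset n) v → lookup p v ≡ true → ∃ λ i → enumerate p i ≡ v
enumerate-surjective (true  ∷ p) zero    _  = zero , refl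
enumerate-surjective (true  ∷ p) (suc v) pv with enumerate-surjective p v pv
... | i , refl = suc i , refl
enumerate-surjective (false ∷ p) (suc v) pv with enumerate-surjective p v pv
... | i , refl = i , refl

∣p∣≡count : ∀ {n} (p : Subset n) → ∣ p ∣ ≡ count (lookup p)
∣p∣≡count []          = refl
∣p∣≡count (true  ∷ p) = cong suc (∣p∣≡count p)
∣p∣≡count (false ∷ p) = ∣p∣≡count p

∣tabulate∣≡count : ∀ {n} (P : Fin n → Bool) → ∣ tabulate P ∣ ≡ count P
∣tabulate∣≡count P = trans (∣p∣≡count (tabulate P)) (sum-cong-≗ (λ v → cong 𝟙 (lookup∘tabulate P v)))

data Side (a b : ℕ) : Fin (a + b) → Set where
  inLeft  : (i : Fin a) → Side a b (i ↑ˡ b)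
  inRight : (j : Fin b) → Side a b (a ↑ʳ j)

side : ∀ a b i → Side a b i
side a b i with splitAt a {b} i in eq
... | inj₁ x = subst (Side a b) (Finₚ.splitAt⁻¹-↑ˡ eq) (inLeft x)
... | inj₂ y = subst (Side a b) (Finₚ.splitAt⁻¹-↑ʳ eq) (inRight y)

module _ {n : ℕ} (G : Graph n) where

  InducedIso-independent : (Z : Subset n) →
    (∀ u w → lookup Z u ≡ true → lookup Z w ≡ true → adj G u w ≡ false) →
    InducedIso G Z (emptyGraph ∣ Z ∣)
  InducedIso-independent Z independent =
    enumerate Z , enumerate-injective Z ,
    (λ v → mk⇔ (λ v∈Z → enumerate-surjective Z v ([]=⇒lookup v∈Z))
               (λ { (i , refl) → lookup⇒[]= _ Z (enumerate-∈ Z i) })) ,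
    (λ i j → independent _ _ (enumerate-∈ Z i) (enumerate-∈ Z j))

  InducedIso-completeBipartite : (Z Q R : Subset n) →
    (∀ v → lookup Z v ≡ lookup Q v ∨ lookup R v) →
    (∀ v → lookup Q v ≡ true → lookup R v ≡ false) →
    (∀ u w → lookup Q u ≡ true → lookup Q w ≡ true → adj G u w ≡ false) →
    (∀ u w → lookup R u ≡ true → lookup R w ≡ true → adj G u w ≡ false) →
    (∀ u w → lookup Q u ≡ true → lookup R w ≡ true → adj G u w ≡ true) →
    InducedIso G Z (completeBipartite ∣ Q ∣ ∣ R ∣)
  InducedIso-completeBipartite Z Q R cover disjoint Q-independent R-independent complete =
    f , injective , image , preserves
    where
    a = ∣ Q ∣
    b = ∣ R ∣
    f : Fin (a + b) → Fin n
    f i = [ enumerate Q , enumerate R ]′ (splitAt a i)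
    f-left : ∀ i → f (i ↑ˡ b) ≡ enumerate Q i
    f-left i rewrite Finₚ.splitAt-↑ˡ a i b = refl
    f-right : ∀ j → f (a ↑ʳ j) ≡ enumerate R j
    f-right j rewrite Finₚ.splitAt-↑ʳ a b j = refl
    Q≢R : ∀ i j → enumerate Q i ≢ enumerate R j
    Q≢R i j eq with () ← trans (sym (disjoint _ (subst (λ v → lookup Q v ≡ true) eq (enumerate-∈ Q i))))
                               (enumerate-∈ R j)
    injective : ∀ {i j} → f i ≡ f j → i ≡ j
    injective {i} {j} eq with side a b i | side a b j
    ... | inLeft x  | inLeft y  = cong (_↑ˡ b) (enumerate-injective Q (trans (sym (f-left x)) (trans eq (f-left y))))
    ... | inRight x | inRight y = cong (a ↑ʳ_) (enumerate-injective R (trans (sym (f-right x)) (trans eq (f-right y))))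
    ... | inLeft x  | inRight y = ⊥-elim (Q≢R x y (trans (sym (f-left x)) (trans eq (f-right y))))
    ... | inRight x | inLeft y  = ⊥-elim (Q≢R y x (sym (trans (sym (f-right x)) (trans eq (f-left y)))))
    f-∈Z : ∀ i → lookup Z (f i) ≡ true
    f-∈Z i with side a b i
    ... | inLeft x  = begin
      lookup Z (f (x ↑ˡ b))                                ≡⟨ cong (lookup Z) (f-left x) ⟩
      lookup Z (enumerate Q x)                             ≡⟨ cover _ ⟩
      lookup Q (enumerate Q x) ∨ lookup R (enumerate Q x)
        ≡⟨ cong (_∨ lookup R (enumerate Q x)) (enumerate-∈ Q x) ⟩
      true                                                 ∎
      where open ≡-Reasoning
    ... | inRight y = begin
      lookup Z (f (a ↑ʳ y))                                ≡⟨ cong (lookup Z) (f-right y) ⟩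
      lookup Z (enumerate R y)                             ≡⟨ cover _ ⟩
      lookup Q (enumerate R y) ∨ lookup R (enumerate R y)
        ≡⟨ cong (lookup Q (enumerate R y) ∨_) (enumerate-∈ R y) ⟩
      lookup Q (enumerate R y) ∨ true                      ≡⟨ ∨-zeroʳ _ ⟩
      true                                                 ∎
      where open ≡-Reasoning
    image : ∀ v → v ∈ Z ⇔ (∃ λ i → f i ≡ v)
    image v = mk⇔ preimage (λ { (i , refl) → lookup⇒[]= _ Z (f-∈Z i) })
      where
      preimage : v ∈ Z → ∃ λ i → f i ≡ v
      preimage v∈Z with ∨≡true (trans (sym (cover v)) ([]=⇒lookup v∈Z))
      ... | inj₁ Qv with enumerate-surjective Q v Qv
      ...   | i , refl = i ↑ˡ b , f-left i
      preimage v∈Z | inj₂ Rv with enumerate-surjective R v Rv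
      ...   | j , refl = a ↑ʳ j , f-right j
    left-side : ∀ i → (toℕ (i ↑ˡ b) <ᵇ a) ≡ true
    left-side i = <⇒<ᵇ≡true (subst (_< a) (sym (Finₚ.toℕ-↑ˡ i b)) (Finₚ.toℕ<n i))
    right-side : ∀ j → (toℕ (a ↑ʳ j) <ᵇ a) ≡ false
    right-side j = ≥⇒<ᵇ≡false (subst (a ≤_) (sym (Finₚ.toℕ-↑ʳ a j)) (m≤m+n a (toℕ j)))
    preserves : ∀ i j → adj G (f i) (f j) ≡ adj (completeBipartite a b) i j
    preserves i j with side a b i | side a b j
    ... | inLeft x  | inLeft y  rewrite left-side x  | left-side y  | f-left x  | f-left y  =
      Q-independent _ _ (enumerate-∈ Q x) (enumerate-∈ Q y)
    ... | inRight x | inRight y rewrite right-side x | right-side y | f-right x | f-right y =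
      R-independent _ _ (enumerate-∈ R x) (enumerate-∈ R y)
    ... | inLeft x  | inRight y rewrite left-side x  | right-side y | f-left x  | f-right y =
      complete _ _ (enumerate-∈ Q x) (enumerate-∈ R y)
    ... | inRight x | inLeft y  rewrite right-side x | left-side y  | f-right x | f-left y  =
      trans (Graph.sym G _ _) (complete _ _ (enumerate-∈ Q y) (enumerate-∈ R x))

  InducedIso-bipartition : (Z : Subset n) {P : Fin n → Bool} → (∀ v → lookup Z v ≡ P v) →
    BalancedBipartition G P → InducedIso G Z (completeBipartite ⌈ count P /2⌉ ⌊ count P /2⌋)
  InducedIso-bipartition Z {P} Z≡P bipartition =
    subst₂ (λ a b → InducedIso G Z (completeBipartite a b))
      (trans (∣tabulate∣≡count left) left-size) (trans (∣tabulate∣≡count right) right-size)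
      (InducedIso-completeBipartite Z (tabulate left) (tabulate right) cover disjoint
        (λ u w Lu Lw → left-independent u w (from-tabulate Lu) (from-tabulate Lw))
        (λ u w Ru Rw → right-independent u w (from-tabulate Ru) (from-tabulate Rw))
        (λ u w Lu Rw → complete u w (from-tabulate Lu) (from-tabulate Rw)))
    where
    open BalancedBipartition bipartition
    from-tabulate : ∀ {Q : Fin n → Bool} {v} → lookup (tabulate Q) v ≡ true → Q v ≡ true
    from-tabulate {Q} {v} = trans (sym (lookup∘tabulate Q v))
    cover : ∀ v → lookup Z v ≡ lookup (tabulate left) v ∨ lookup (tabulate right) v
    cover v = trans (Z≡P v) (trans (𝟙-split⇒∨ (P v) (left v) (right v) (SplitsInto.at splits v))
                (sym (cong₂ _∨_ (lookup∘tabulate left v) (lookup∘tabulate right v))))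
    disjoint : ∀ v → lookup (tabulate left) v ≡ true → lookup (tabulate right) v ≡ false
    disjoint v Lv = trans (lookup∘tabulate right v)
      (𝟙-split⇒disjoint (P v) (left v) (right v) (SplitsInto.at splits v) (from-tabulate Lv))

ExtremalDecomposition : ∀ {n} → Graph n → (δ k y : ℕ) → Set
ExtremalDecomposition {n} G δ k y = Σ (Subset n) (λ X → Σ (Subset n) (λ S → Σ (Subset n) (λ Y →
  Partition3 G X S Y
  × IsMinVertexCut G S
  × InducedIso G S (emptyGraph (k ∸ 1))
  × InducedIso G (X ∪ S) (completeBipartite δ δ)
  × InducedIso G (Y ∪ S) (completeBipartite ((y + 1) / 2) (y / 2)))))

∈-tabulate⁻ : ∀ {n} {P : Fin n → Bool} {v} → v ∈ tabulate P → P v ≡ true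
∈-tabulate⁻ {P = P} {v} v∈P = trans (sym (lookup∘tabulate P v)) ([]=⇒lookup v∈P)

∈-tabulate⁺ : ∀ {n} {P : Fin n → Bool} {v} → P v ≡ true → v ∈ tabulate P
∈-tabulate⁺ {P = P} {v} Pv = lookup⇒[]= v _ (trans (lookup∘tabulate P v) Pv)

lookup-tabulate-∪ : ∀ {n} (X : Fin n → Bool) (S : Subset n) v →
                    lookup (tabulate X ∪ S) v ≡ X v ∨ lookup S v
lookup-tabulate-∪ X S v =
  trans (lookup-zipWith _∨_ v (tabulate X) S) (cong (_∨ lookup S v) (lookup∘tabulate X v))

module _ {n : ℕ} (G : Graph n) where

  partition : (S : Subset n) (X Y : Fin n → Bool) →
    SplitsInto everyVertex (λ v → X v ∨ lookup S v) Y → SplitsInto (λ v → X v ∨ lookup S v) X (lookup S) →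
    Partition3 G (tabulate X) S (tabulate Y)
  partition S X Y (pointwise V-splits) (pointwise XS-splits) = cover , X∩S , X∩Y , S∩Y
    where
    X∨S≡true : ∀ {v} → X v ≡ true ⊎ lookup S v ≡ true → X v ∨ lookup S v ≡ true
    X∨S≡true {v} (inj₁ Xv) = cong (_∨ lookup S v) Xv
    X∨S≡true {v} (inj₂ Sv) = trans (cong (X v ∨_) Sv) (∨-zeroʳ (X v))
    cover : ∀ v → v ∈ tabulate X ⊎ v ∈ S ⊎ v ∈ tabulate Y
    cover v with ∨≡true (sym (𝟙-split⇒∨ true _ (Y v) (V-splits v)))
    ... | inj₂ Yv = inj₂ (inj₂ (∈-tabulate⁺ Yv))
    ... | inj₁ X∨Sv with ∨≡true X∨Sv
    ...   | inj₁ Xv = inj₁ (∈-tabulate⁺ Xv)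
    ...   | inj₂ Sv = inj₂ (inj₁ (lookup⇒[]= v S Sv))
    X∩S : ∀ v → v ∈ tabulate X → v ∈ S → ⊥
    X∩S v v∈X v∈S with () ← trans (sym ([]=⇒lookup v∈S))
                                  (𝟙-split⇒disjoint _ (X v) _ (XS-splits v) (∈-tabulate⁻ v∈X))
    Y-disjoint : ∀ {v} → X v ≡ true ⊎ lookup S v ≡ true → v ∈ tabulate Y → ⊥
    Y-disjoint {v} in-X∨S v∈Y with () ← trans (sym (∈-tabulate⁻ v∈Y))
                                            (𝟙-split⇒disjoint true _ (Y v) (V-splits v) (X∨S≡true in-X∨S))
    X∩Y : ∀ v → v ∈ tabulate X → v ∈ tabulate Y → ⊥
    X∩Y v v∈X = Y-disjoint (inj₁ (∈-tabulate⁻ v∈X))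
    S∩Y : ∀ v → v ∈ S → v ∈ tabulate Y → ⊥
    S∩Y v v∈S = Y-disjoint (inj₂ ([]=⇒lookup v∈S))

  extremal-decomposition : ∀ {δ k y} (S : Subset n) (X Y : Fin n → Bool) →
    SplitsInto everyVertex (λ v → X v ∨ lookup S v) Y → SplitsInto (λ v → X v ∨ lookup S v) X (lookup S) →
    IsMinVertexCut G S → ∣ S ∣ ≡ k ∸ 1 →
    (∀ u w → lookup S u ≡ true → lookup S w ≡ true → adj G u w ≡ false) →
    BalancedBipartition G (λ v → X v ∨ lookup S v) → count (λ v → X v ∨ lookup S v) ≡ δ + δ →
    BalancedBipartition G (λ v → Y v ∨ lookup S v) → count (λ v → Y v ∨ lookup S v) ≡ y →
    ExtremalDecomposition G δ k y
  extremal-decomposition {δ} {k} {y} S X Y V-splits XS-splits S-min ∣S∣≡k-1 S-independent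
                         X-bipartition ∣X∪S∣≡2δ Y-bipartition ∣Y∪S∣≡y =
    tabulate X , S , tabulate Y , partition S X Y V-splits XS-splits , S-min ,
    subst (λ r → InducedIso G S (emptyGraph r)) ∣S∣≡k-1 (InducedIso-independent G S S-independent) ,
    subst₂ (λ a b → InducedIso G (tabulate X ∪ S) (completeBipartite a b))
      (trans (cong ⌈_/2⌉ ∣X∪S∣≡2δ) (sym (n≡⌈n+n/2⌉ δ)))
      (trans (cong ⌊_/2⌋ ∣X∪S∣≡2δ) (sym (n≡⌊n+n/2⌋ δ)))
      (InducedIso-bipartition G (tabulate X ∪ S) (lookup-tabulate-∪ X S) X-bipartition) ,
    subst₂ (λ a b → InducedIso G (tabulate Y ∪ S) (completeBipartite a b))
      (trans (cong ⌈_/2⌉ ∣Y∪S∣≡y) (trans (cong ⌊_/2⌋ (+-comm 1 y)) (⌊n/2⌋≡n/2 (y + 1))))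
      (trans (cong ⌊_/2⌋ ∣Y∪S∣≡y) (⌊n/2⌋≡n/2 y))
      (InducedIso-bipartition G (tabulate Y ∪ S) (lookup-tabulate-∪ Y S) Y-bipartition)

complete-not-triangle-free : ∀ {n} (G : Graph n) → IsComplete G → TriangleFree G →
                             ∀ v → 2 ≤ degree G v → ⊥
complete-not-triangle-free G complete triangle-free v 2≤deg
  with count≥2⇒∃₂ (adj G v) (subst (2 ≤_) (degree≡degreeIn G v) 2≤deg)
... | a , b , a≢b , va , vb = triangle-free v a b va (complete a b a≢b) vb

module SmallCut {n : ℕ} (G : Graph n) (triangle-free : TriangleFree G) {δ k : ℕ}
                (min-degree : ∀ v → δ ≤ degree G v) (2≤k : 2 ≤ k) (k≤δ : k ≤ δ)
                (S : Subset n) (S-min : IsMinVertexCut G S) (∣S∣<k : ∣ S ∣ < k)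
                (u₀ v₀ : Fin n) (u₀∉S : u₀ ∉ S) (v₀∉S : v₀ ∉ S) (separated : ¬ Reach G (∁ S) u₀ v₀)
                (size-bound : δ * δ + ((n + k ∸ (2 * δ + 1)) * (n + k ∸ (2 * δ + 1))) / 4 ≤ size G) where

  y budget : ℕ
  y = n + k ∸ (2 * δ + 1)
  budget = δ * δ + ⌊ y ²/4⌋

  component-of-u₀ : ∃ λ A → A u₀ ≡ true × (∀ v → A v ≡ true → Reach G (∁ S) u₀ v)
                          × ClosedOutside G S A
  component-of-u₀ = component G S u₀ (x∉p⇒x∈∁p u₀∉S)

  A : Fin n → Bool
  A = proj₁ component-of-u₀

  A-u₀ : A u₀ ≡ true
  A-u₀ = proj₁ (proj₂ component-of-u₀)

  A-reachable : ∀ v → A v ≡ true → Reach G (∁ S) u₀ v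
  A-reachable = proj₁ (proj₂ (proj₂ component-of-u₀))

  A-closed : ClosedOutside G S A
  A-closed = proj₂ (proj₂ (proj₂ component-of-u₀))

  A-avoids-S : ∀ v → A v ≡ true → lookup S v ≡ false
  A-avoids-S v Av = ∈∁⇒lookup≡false S (reach-end G (A-reachable v Av))

  A-v₀ : A v₀ ≡ false
  A-v₀ with A v₀ in Av₀
  ... | false = refl
  ... | true  = contradiction (A-reachable v₀ Av₀) separated

  open CutSides G S A A-avoids-S A-closed

  B-v₀ : B v₀ ≡ true
  B-v₀ rewrite A-v₀ | ∈∁⇒lookup≡false S (x∉p⇒x∈∁p v₀∉S) = refl

  count-S<k : count inS < k
  count-S<k = subst (_< k) (∣p∣≡count S) ∣S∣<k

  count-S<δ : count inS < δ
  count-S<δ = ≤-trans count-S<k k≤δ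

  T-mantel : arcs G T T ≤ ⌊ count T ²/4⌋ + ⌊ count T ²/4⌋
  T-mantel = mantel G triangle-free u₀ T

  U-mantel : arcs G U U ≤ ⌊ count U ²/4⌋ + ⌊ count U ²/4⌋
  U-mantel = mantel G triangle-free u₀ U

  budget-twice : budget + budget ≤ arcs G everyVertex everyVertex
  budget-twice = ≤-trans (+-mono-≤ budget≤size budget≤size) (≤-reflexive (sym (handshake G)))
    where
    budget≤size : budget ≤ size G
    budget≤size = subst (λ q → δ * δ + q ≤ size G) (sym (⌊n²/4⌋≡n*n/4 y)) size-bound

  budget≤ : budget ≤ ⌊ count T ²/4⌋ + ⌊ count U ²/4⌋
  budget≤ = m+m≤n+n⇒m≤n (begin
    budget + budget                                            ≤⟨ budget-twice ⟩
    arcs G everyVertex everyVertex                             ≤⟨ m≤m+n _ (arcs G inS inS) ⟩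
    arcs G everyVertex everyVertex + arcs G inS inS            ≡⟨ arcs-V+S≡arcs-T+U ⟩
    arcs G T T + arcs G U U                                    ≤⟨ +-mono-≤ T-mantel U-mantel ⟩
    ⌊ count T ²/4⌋ + ⌊ count T ²/4⌋ + (⌊ count U ²/4⌋ + ⌊ count U ²/4⌋)
                                                               ≡⟨ regroup ⌊ count T ²/4⌋ ⌊ count U ²/4⌋ ⟩
    ⌊ count T ²/4⌋ + ⌊ count U ²/4⌋ + (⌊ count T ²/4⌋ + ⌊ count U ²/4⌋) ∎)
    where
    open ≤-Reasoning
    regroup : ∀ f g → f + f + (g + g) ≡ f + g + (f + g)
    regroup = solve-∀

  module Tight (balanced : ⌊ count T ²/4⌋ + ⌊ count U ²/4⌋ ≡ budget) where

    squeezed : arcs G inS inS ≡ 0 × ⌊ count T ²/4⌋ + ⌊ count T ²/4⌋ ≤ arcs G T T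
             × ⌊ count U ²/4⌋ + ⌊ count U ²/4⌋ ≤ arcs G U U
    squeezed = squeeze {f = ⌊ count T ²/4⌋} {g = ⌊ count U ²/4⌋}
                       budget-twice arcs-V+S≡arcs-T+U T-mantel U-mantel balanced

    S-independent : ∀ u w → lookup S u ≡ true → lookup S w ≡ true → adj G u w ≡ false
    S-independent = arcs≡0⇒nonadjacent G (proj₁ squeezed)

    T-bipartition : BalancedBipartition G T
    T-bipartition = mantel-equality G triangle-free u₀ T (proj₁ (proj₂ squeezed))

    U-bipartition : BalancedBipartition G U
    U-bipartition = mantel-equality G triangle-free u₀ U (proj₂ (proj₂ squeezed))

  ∣S∣≡k∸1 : suc (count inS) ≡ k → ∣ S ∣ ≡ k ∸ 1
  ∣S∣≡k∸1 1+∣S∣≡k = trans (∣p∣≡count S) (cong (_∸ 1) 1+∣S∣≡k)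

  decompose : suc (count inS) ≡ k →
    (count T ≡ δ + δ × count U ≡ y) ⊎ (count U ≡ δ + δ × count T ≡ y) → ExtremalDecomposition G δ k y
  decompose 1+∣S∣≡k (inj₁ (T≡2δ , U≡y)) =
    extremal-decomposition G {δ} {k} {y} S A B V-splits T-splits S-min (∣S∣≡k∸1 1+∣S∣≡k) S-independent
      T-bipartition T≡2δ U-bipartition U≡y
    where open Tight (cong₂ _+_ (trans (cong ⌊_²/4⌋ T≡2δ) (⌊[d+d]²/4⌋≡d*d δ)) (cong ⌊_²/4⌋ U≡y))
  decompose 1+∣S∣≡k (inj₂ (U≡2δ , T≡y)) =
    extremal-decomposition G {δ} {k} {y} S B A V-splits′ U-splits S-min (∣S∣≡k∸1 1+∣S∣≡k) S-independent
      U-bipartition U≡2δ T-bipartition T≡y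
    where
    open Tight (trans (+-comm ⌊ count T ²/4⌋ ⌊ count U ²/4⌋)
                      (cong₂ _+_ (trans (cong ⌊_²/4⌋ U≡2δ) (⌊[d+d]²/4⌋≡d*d δ)) (cong ⌊_²/4⌋ T≡y)))

  decomposition : ExtremalDecomposition G δ k y
  decomposition = uncurry decompose (extremal-sizes 1≤δ count-S<k count-T+U T≥2δ U≥2δ budget≤)
    where
    1≤δ : 1 ≤ δ
    1≤δ = ≤-trans (s≤s z≤n) (≤-trans 2≤k k≤δ)
    T≥2δ : δ + δ ≤ count T
    T≥2δ = closed-side≥2δ G triangle-free min-degree inS A count-S<δ A-side-closed u₀ A-u₀
    U≥2δ : δ + δ ≤ count U
    U≥2δ = closed-side≥2δ G triangle-free min-degree inS B count-S<δ B-side-closed v₀ B-v₀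

theorem5p2 : (n : ℕ) (G : Graph n) (δ κ k : ℕ) →
    Connected G → TriangleFree G → IsMinDegree G δ → IsConnectivity G κ →
    2 ≤ k → k ≤ δ →
    δ * δ + ((n + k ∸ (2 * δ + 1)) * (n + k ∸ (2 * δ + 1))) / 4 ≤ size G →
    k ≤ κ
    ⊎ Σ (Subset n) (λ X → Σ (Subset n) (λ S → Σ (Subset n) (λ Y →
        Partition3 G X S Y
        × IsMinVertexCut G S
        × InducedIso G S (emptyGraph (k ∸ 1))
        × InducedIso G (X ∪ S) (completeBipartite δ δ)
        × InducedIso G (Y ∪ S)
            (completeBipartite ((n + k ∸ (2 * δ + 1) + 1) / 2) ((n + k ∸ (2 * δ + 1)) / 2)))))
theorem5p2 n G δ κ k _ triangle-free (min-degree , v , _) (inj₁ (complete , _)) 2≤k k≤δ _ =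
  ⊥-elim (complete-not-triangle-free G complete triangle-free v
           (≤-trans 2≤k (≤-trans k≤δ (min-degree v))))
theorem5p2 n G δ κ k _ triangle-free (min-degree , _) (inj₂ (_ , (S , cut , ∣S∣≡κ) , κ-minimal))
           2≤k k≤δ size-bound
  with k ≤? κ | cut
... | yes k≤κ | _ = inj₁ k≤κ
... | no  k≰κ | u₀ , v₀ , u₀∉S , v₀∉S , separated =
  inj₂ (SmallCut.decomposition G triangle-free min-degree 2≤k k≤δ S S-min
          (subst (_< k) (sym ∣S∣≡κ) (≰⇒> k≰κ)) u₀ v₀ u₀∉S v₀∉S separated size-bound)
  where
  S-min : IsMinVertexCut G S
  S-min = cut , λ T T-cut → subst (_≤ ∣ T ∣) (sym ∣S∣≡κ) (κ-minimal T T-cut)
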